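{- Let $\vec a=(a_1,\ldots,a_n)$ be a vector of relatively prime positive integers. For $1\le i\le n$, let $d_i=\gcd(\vec a_{ -i})$, and let $p=d_1\cdots d_n$. Then: \begin{enumerate} \item If $s\in\mathbb{Z}_{\ge 0}$ and $b_i\in\mathbb{Z}$ with $0\le b_i<d_i$ for all $i$, then $f\left(\vec a; sp+\sum_i a_ib_i\right)=f(\vec a; sp)$. \item If $t\in\mathbb{Z}_{\ge 0}$ is sufficiently large, then there exist $s\in\mathbb{Z}_{\ge 0}$ and $b_i\in\mathbb{Z}$ with $0\le b_i<d_i$ such that $t=sp+\sum_i a_ib_i$. \item For $1\le i\le n$, let $a'_i=\dfrac{a_i}{\prod_{j\ne i}d_j}$ and $\vec a'=(a'_1,\ldots,a'_n)$. Then $f(\vec a; sp)=f(\vec a'; s)$ for all $s\in\mathbb{Z}_{\ge 0}$. \item For all sufficiently large $s\in\mathbb{Z}_{\ge 0}$, $f\big(\vec a;(s+1)p\big)>f(\vec a; sp)$. \end{enumerate}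
   Context: For a vector $\vec a=(a_1,\ldots,a_n)$ of positive integers and $t\in\mathbb{Z}_{\ge 0}$, the restricted partition function is $f(\vec a;t)=\#\{(x_1,\ldots,x_n)\in\mathbb{Z}_{\ge 0}^n:\ a_1x_1+\cdots+a_nx_n=t\}$. For $1\le i\le n$, $\vec a_{ -i}=(a_1,\ldots,a_{i-1},a_{i+1},\ldots,a_n)$. -}

module Defs where

open import Data.Nat using (ℕ; zero; suc; _+_; _*_; _/_)
open import Data.Nat.GCD using (gcd)
open import Data.Nat.Properties using (_≟_)
open import Data.Fin using (Fin)
import Data.Fin.Properties as FinP
open import Data.List using (List; []; _∷_; map; foldr; filter; length; upTo; concatMap; allFin)
open import Data.Nat.ListAction using (sum; product)
open import Data.Vec using (Vec; []; _∷_; lookup; tabulate; toList)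
open import Relation.Nullary using (¬?)

box : (n t : ℕ) → List (Vec ℕ n)
box zero    t = [] ∷ []
box (suc n) t = concatMap (λ x → map (x ∷_) (box n t)) (upTo (suc t))

dot : {n : ℕ} → (Fin n → ℕ) → (Fin n → ℕ) → ℕ
dot {n} a x = sum (map (λ i → a i * x i) (allFin n))

-- restricted partition function f(a; t) = #{x ∈ ℕⁿ : a·x = t}.
-- For positive a every solution satisfies xᵢ ≤ t, so the solution set is
-- exactly the vectors in {0,…,t}ⁿ with a·x = t; we count those.
f : {n : ℕ} → (Fin n → ℕ) → ℕ → ℕ
f {n} a t = length (filter (λ x → dot a (lookup x) ≟ t) (box n t))

-- gcd of a list of naturals (gcd of the empty list is 0)
gcdL : List ℕ → ℕ
gcdL = foldr gcd 0

others : {n : ℕ} → Fin n → List (Fin n)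
others {n} i = filter (λ j → ¬? (j FinP.≟ i)) (allFin n)

gcdV : {n : ℕ} → (Fin n → ℕ) → ℕ
gcdV {n} a = gcdL (map a (allFin n))

dᵢ : {n : ℕ} → (Fin n → ℕ) → Fin n → ℕ
dᵢ a i = gcdL (map a (others i))

pOf : {n : ℕ} → (Fin n → ℕ) → ℕ
pOf {n} a = product (map (dᵢ a) (allFin n))

-- total natural division (m div 0 = 0); only used where division is exact
_div_ : ℕ → ℕ → ℕ
m div zero  = 0
m div suc k = m / suc k

a′ : {n : ℕ} → (Fin n → ℕ) → Fin n → ℕ
a′ a i = a i div product (map (dᵢ a) (others i))

-- Let f be the coefficient sequence of ∏ᵢ 1/(1 − z^aᵢ). As dᵢ divides every aⱼ with j ≠ i and is
-- coprime to aᵢ, sieving the factor 1/(1 − z^aᵢ) along residues modulo dᵢ shows that f is constant on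
-- s p + Σ aᵢ bᵢ (0 ≤ bᵢ < dᵢ) and that f (s p) is the coefficient of z^(s p) in ∏ᵢ 1/(1 − z^(aᵢ dᵢ)),
-- where aᵢ dᵢ = p a′ᵢ; this gives parts 1 and 3, and part 2 is the Chinese remainder theorem.
-- Any n − 1 of the a′ᵢ are coprime. Replacing two generators by their gcd and lcm changes the
-- increments f (s + 1) − f (s) by O(s^(n−3)) only, and repeating this turns a′ into (1, 1, R) with
-- ∣R∣ = n − 2, whose increments are the partition counts of (1, R), of order s^(n−2). This gives part 4.

module Submission where

open import Defs
open import Data.Nat
open import Data.Nat.Properties
open import Data.Nat.Divisibility
open import Data.Nat.DivMod using (m%n<n; m%n≤m; m≡m%n+[m/n]*n; m*[n/m]≡n; m/n*n≤m; m*n/n≡m; /-monoˡ-≤)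
open import Data.Nat.GCD using (gcd; gcd[m,n]∣m; gcd[m,n]∣n; gcd-greatest; gcd-GCD; gcd-assoc; gcd-identityʳ; module Bézout)
open import Data.Nat.LCM using (lcm; m∣lcm[m,n]; n∣lcm[m,n]; lcm-least; gcd*lcm)
open import Data.Nat.Coprimality as Coprime using (Coprime; coprime-divisor; coprime⇒gcd≡1; gcd≡1⇒coprime; coprime-Bézout)
open import Data.Nat.Induction using (<-rec)
open import Data.Nat.ListAction using (sum; product)
open import Data.Nat.Tactic.RingSolver using (solve-∀)
open import Data.Bool using (true; false)
open import Data.Fin using (Fin; zero; suc)
import Data.Fin.Properties as Fin
open import Data.List using (List; []; _∷_; _++_; [_]; map; filter; length; upTo; applyUpTo; concatMap; concat; allFin; tabulate)
open import Data.List.Properties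
  using (map-tabulate; tabulate-cong; length-tabulate; filter-accept; filter-reject; filter-all; length-++; ++-assoc; ++-identityʳ)
open import Data.List.Membership.Propositional using (_∈_)
open import Data.List.Membership.Propositional.Properties
  using (∈-map⁺; ∈-map⁻; ∈-filter⁺; ∈-filter⁻; ∈-allFin; ∈-∃++)
open import Data.List.Relation.Unary.Any using (here; there)
open import Data.List.Relation.Unary.All as All using (All; []; _∷_)
open import Data.List.Relation.Unary.All.Properties using (tabulate⁺; tabulate⁻)
open import Data.List.Relation.Unary.AllPairs using ([]; _∷_)
open import Data.List.Relation.Unary.Unique.Propositional using (Unique)
import Data.List.Relation.Unary.Unique.Propositional.Properties as Unique
open import Data.List.Relation.Binary.Permutation.Propositional as ↭ using (_↭_; ↭-sym; ↭-prep; ↭-refl)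
open import Data.List.Relation.Binary.Permutation.Propositional.Properties
  using (All-resp-↭; ↭-length; ∷↭∷ʳ) renaming (shift to ↭-shift)
open import Data.Vec using (Vec; lookup)
open import Data.Product using (∃; ∃₂; ∃-syntax; _,_; _×_; proj₁; proj₂)
open import Data.Sum using (_⊎_; inj₁; inj₂)
open import Data.Unit using (⊤; tt)
open import Data.Empty using (⊥-elim)
open import Function using (_∘_; id)
open import Level using (0ℓ)
open import Relation.Nullary using (yes; no; ¬_; ¬?; Dec; does)
open import Relation.Unary using (Pred; Decidable)
open import Relation.Binary.PropositionalEquality hiding (J; [_])

-- Sequences stand for power series in z: _⋆_ is their product, shift c multiplies by zᶜ,
-- multiples c is 1/(1 − zᶜ) and partitions cs is ∏_{c ∈ cs} 1/(1 − zᶜ).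
Seq : Set
Seq = ℕ → ℕ

≗-trans : {u v w : Seq} → u ≗ v → v ≗ w → u ≗ w
≗-trans e e′ t = trans (e t) (e′ t)

≗-sym : {u v : Seq} → u ≗ v → v ≗ u
≗-sym e t = sym (e t)

one : Seq
one zero    = 1
one (suc _) = 0

infixl 7 _⋆_ _∙_
infixl 6 _⊕_

_⋆_ : Seq → Seq → Seq
(u ⋆ v) zero    = u 0 * v 0
(u ⋆ v) (suc s) = u 0 * v (suc s) + ((u ∘ suc) ⋆ v) s

_⊕_ : Seq → Seq → Seq
(u ⊕ v) t = u t + v t

_∙_ : ℕ → Seq → Seq
(k ∙ u) t = k * u t

shift : ℕ → Seq → Seq
shift zero    u t       = u t
shift (suc c) u zero    = 0
shift (suc c) u (suc t) = shift c u t

shift-< : ∀ c u {t} → t < c → shift c u t ≡ 0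
shift-< (suc c) u {zero}  _         = refl
shift-< (suc c) u {suc t} (s≤s t<c) = shift-< c u t<c

shift-+ : ∀ c u t → shift c u (c + t) ≡ u t
shift-+ zero    u t = refl
shift-+ (suc c) u t = shift-+ c u t

shift-cong : ∀ c {u v} → u ≗ v → shift c u ≗ shift c v
shift-cong zero    e t       = e t
shift-cong (suc c) e zero    = refl
shift-cong (suc c) e (suc t) = shift-cong c e t

shift-shift : ∀ a b u → shift (a + b) u ≗ shift a (shift b u)
shift-shift zero    b u t       = refl
shift-shift (suc a) b u zero    = refl
shift-shift (suc a) b u (suc t) = shift-shift a b u t

shift-⊕ : ∀ c u v → shift c (u ⊕ v) ≗ shift c u ⊕ shift c v
shift-⊕ zero    u v t       = refl
shift-⊕ (suc c) u v zero    = refl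
shift-⊕ (suc c) u v (suc t) = shift-⊕ c u v t

⊕-cong : ∀ {u u′ v v′} → u ≗ u′ → v ≗ v′ → u ⊕ v ≗ u′ ⊕ v′
⊕-cong e e′ t = cong₂ _+_ (e t) (e′ t)

⋆-cong : ∀ {u u′ v v′} → u ≗ u′ → v ≗ v′ → u ⋆ v ≗ u′ ⋆ v′
⋆-cong eu ev zero    = cong₂ _*_ (eu 0) (ev 0)
⋆-cong eu ev (suc s) = cong₂ _+_ (cong₂ _*_ (eu 0) (ev (suc s))) (⋆-cong (eu ∘ suc) ev s)

⋆-zeroˡ : ∀ v → (λ _ → 0) ⋆ v ≗ λ _ → 0
⋆-zeroˡ v zero    = refl
⋆-zeroˡ v (suc s) = ⋆-zeroˡ v s

⋆-identityˡ : ∀ v → one ⋆ v ≗ v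
⋆-identityˡ v zero    = *-identityˡ (v 0)
⋆-identityˡ v (suc s) = trans (cong₂ _+_ (*-identityˡ (v (suc s))) (⋆-zeroˡ v s)) (+-identityʳ _)

⋆-distribʳ-⊕ : ∀ w u v → (u ⊕ v) ⋆ w ≗ u ⋆ w ⊕ v ⋆ w
⋆-distribʳ-⊕ w u v zero    = *-distribʳ-+ (w 0) (u 0) (v 0)
⋆-distribʳ-⊕ w u v (suc s) =
  trans (cong₂ _+_ (*-distribʳ-+ (w (suc s)) (u 0) (v 0)) (⋆-distribʳ-⊕ w (u ∘ suc) (v ∘ suc) s))
        (+-interchange (u 0 * w (suc s)) _ _ _ )
  where
  +-interchange : ∀ a b c d → (a + b) + (c + d) ≡ (a + c) + (b + d)
  +-interchange = solve-∀

⋆-distribˡ-⊕ : ∀ u v w → u ⋆ (v ⊕ w) ≗ u ⋆ v ⊕ u ⋆ w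
⋆-distribˡ-⊕ u v w zero    = *-distribˡ-+ (u 0) (v 0) (w 0)
⋆-distribˡ-⊕ u v w (suc s) =
  trans (cong₂ _+_ (*-distribˡ-+ (u 0) (v (suc s)) (w (suc s))) (⋆-distribˡ-⊕ (u ∘ suc) v w s))
        (+-interchange (u 0 * v (suc s)) _ _ _)
  where
  +-interchange : ∀ a b c d → (a + b) + (c + d) ≡ (a + c) + (b + d)
  +-interchange = solve-∀

⋆-∙ˡ : ∀ k u v → (k ∙ u) ⋆ v ≗ k ∙ (u ⋆ v)
⋆-∙ˡ k u v zero    = *-assoc k (u 0) (v 0)
⋆-∙ˡ k u v (suc s) =
  trans (cong₂ _+_ (*-assoc k (u 0) (v (suc s))) (⋆-∙ˡ k (u ∘ suc) v s)) (sym (*-distribˡ-+ k _ _))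

⋆-last : ∀ u v s → (u ⋆ v) (suc s) ≡ (u ⋆ (v ∘ suc)) s + u (suc s) * v 0
⋆-last u v zero    = refl
⋆-last u v (suc s) =
  trans (cong (u 0 * v (suc (suc s)) +_) (⋆-last (u ∘ suc) v s)) (sym (+-assoc (u 0 * v (suc (suc s))) _ _))

⋆-comm : ∀ u v → u ⋆ v ≗ v ⋆ u
⋆-comm u v zero    = *-comm (u 0) (v 0)
⋆-comm u v (suc s) = begin
  u 0 * v (suc s) + ((u ∘ suc) ⋆ v) s  ≡⟨ cong₂ _+_ (*-comm (u 0) (v (suc s))) (⋆-comm (u ∘ suc) v s) ⟩
  v (suc s) * u 0 + (v ⋆ (u ∘ suc)) s  ≡⟨ +-comm (v (suc s) * u 0) _ ⟩
  (v ⋆ (u ∘ suc)) s + v (suc s) * u 0  ≡⟨ ⋆-last v u s ⟨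
  (v ⋆ u) (suc s)                      ∎
  where open ≡-Reasoning

⋆-assoc : ∀ u v w → (u ⋆ v) ⋆ w ≗ u ⋆ (v ⋆ w)
⋆-assoc u v w zero    = *-assoc (u 0) (v 0) (w 0)
⋆-assoc u v w (suc s) = begin
  (u ⋆ v) 0 * w (suc s) + ((u 0 ∙ (v ∘ suc) ⊕ (u ∘ suc) ⋆ v) ⋆ w) s
    ≡⟨ cong (u 0 * v 0 * w (suc s) +_) (⋆-distribʳ-⊕ w (u 0 ∙ (v ∘ suc)) ((u ∘ suc) ⋆ v) s) ⟩
  (u ⋆ v) 0 * w (suc s) + (((u 0 ∙ (v ∘ suc)) ⋆ w) s + (((u ∘ suc) ⋆ v) ⋆ w) s)
    ≡⟨ cong₂ (λ a b → u 0 * v 0 * w (suc s) + (a + b)) (⋆-∙ˡ (u 0) (v ∘ suc) w s) (⋆-assoc (u ∘ suc) v w s) ⟩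
  u 0 * v 0 * w (suc s) + (u 0 * ((v ∘ suc) ⋆ w) s + ((u ∘ suc) ⋆ (v ⋆ w)) s)
    ≡⟨ rearrange (u 0) (v 0) (w (suc s)) _ _ ⟩
  u 0 * (v 0 * w (suc s) + ((v ∘ suc) ⋆ w) s) + ((u ∘ suc) ⋆ (v ⋆ w)) s
    ∎
  where
  open ≡-Reasoning
  rearrange : ∀ a b c d e → a * b * c + (a * d + e) ≡ a * (b * c + d) + e
  rearrange = solve-∀

⋆-shiftˡ : ∀ c u v → shift c u ⋆ v ≗ shift c (u ⋆ v)
⋆-shiftˡ zero    u v t       = refl
⋆-shiftˡ (suc c) u v zero    = refl
⋆-shiftˡ (suc c) u v (suc t) = ⋆-shiftˡ c u v t

⋆-shiftʳ : ∀ c u v → u ⋆ shift c v ≗ shift c (u ⋆ v)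
⋆-shiftʳ c u v = ≗-trans (⋆-comm u (shift c v)) (≗-trans (⋆-shiftˡ c v u) (shift-cong c (⋆-comm v u)))

⋆-vanish : ∀ u v t → (∀ i j → i + j ≡ t → u i ≡ 0 ⊎ v j ≡ 0) → (u ⋆ v) t ≡ 0
⋆-vanish u v zero    h with h 0 0 refl
... | inj₁ e = cong (_* v 0) e
... | inj₂ e = trans (cong (u 0 *_) e) (*-zeroʳ (u 0))
⋆-vanish u v (suc t) h =
  cong₂ _+_ head (⋆-vanish (u ∘ suc) v t (λ i j e → h (suc i) j (cong suc e)))
  where
  head : u 0 * v (suc t) ≡ 0
  head with h 0 (suc t) refl
  ... | inj₁ e = cong (_* v (suc t)) e
  ... | inj₂ e = trans (cong (u 0 *_) e) (*-zeroʳ (u 0))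

multiples : ℕ → Seq
multiples c t with c ∣? t
... | yes _ = 1
... | no _  = 0

multiples-∣ : ∀ {c t} → c ∣ t → multiples c t ≡ 1
multiples-∣ {c} {t} c∣t with c ∣? t
... | yes _  = refl
... | no c∤t = ⊥-elim (c∤t c∣t)

multiples-∤ : ∀ {c t} → ¬ c ∣ t → multiples c t ≡ 0
multiples-∤ {c} {t} c∤t with c ∣? t
... | yes c∣t = ⊥-elim (c∤t c∣t)
... | no _    = refl

multiples-≤1 : ∀ c t → multiples c t ≤ 1
multiples-≤1 c t with c ∣? t
... | yes _ = ≤-refl
... | no _  = z≤n

multiples-pos⇒∣ : ∀ {c t} → 0 < multiples c t → c ∣ t
multiples-pos⇒∣ {c} {t} h with c ∣? t
... | yes c∣t = c∣t
... | no _    = ⊥-elim (<⇒≱ h z≤n)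

multiples-+ : ∀ {c} m t → c ∣ m → multiples c (m + t) ≡ multiples c t
multiples-+ {c} m t c∣m with c ∣? t
... | yes c∣t = multiples-∣ (∣m∣n⇒∣m+n c∣m c∣t)
... | no c∤t  = multiples-∤ (λ c∣m+t → c∤t (∣m+n∣m⇒∣n c∣m+t c∣m))

<-or-+ : ∀ c t → t < c ⊎ ∃ λ k → t ≡ c + k
<-or-+ c t with t <? c
... | yes t<c = inj₁ t<c
... | no t≮c  = inj₂ (t ∸ c , sym (m+[n∸m]≡n (≮⇒≥ t≮c)))

multiples-rec : ∀ {c} → 0 < c → multiples c ≗ one ⊕ shift c (multiples c)
multiples-rec {c} c>0 zero = trans (multiples-∣ (c ∣0)) (cong (1 +_) (sym (shift-< c _ c>0)))
multiples-rec {c} c>0 (suc t) with <-or-+ c (suc t)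
... | inj₁ t<c = trans (multiples-∤ (λ c∣t → <⇒≱ t<c (∣⇒≤ c∣t))) (sym (shift-< c _ t<c))
... | inj₂ (k , t+1≡c+k) rewrite t+1≡c+k = trans (multiples-+ c k ∣-refl) (sym (shift-+ c _ k))

⋆-multiples-rec : ∀ {c} → 0 < c → ∀ G → multiples c ⋆ G ≗ G ⊕ shift c (multiples c ⋆ G)
⋆-multiples-rec {c} c>0 G =
  ≗-trans (⋆-cong (multiples-rec c>0) (λ _ → refl))
  (≗-trans (⋆-distribʳ-⊕ G one (shift c (multiples c)))
           (⊕-cong (⋆-identityˡ G) (⋆-shiftˡ c (multiples c) G)))

⋆-multiples-+ : ∀ {c} → 0 < c → ∀ G k → (multiples c ⋆ G) (c + k) ≡ G (c + k) + (multiples c ⋆ G) k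
⋆-multiples-+ {c} c>0 G k = trans (⋆-multiples-rec c>0 G (c + k)) (cong (G (c + k) +_) (shift-+ c _ k))

⋆-multiples-< : ∀ {c} → 0 < c → ∀ G {t} → t < c → (multiples c ⋆ G) t ≡ G t
⋆-multiples-< {c} c>0 G {t} t<c =
  trans (⋆-multiples-rec c>0 G t) (trans (cong (G t +_) (shift-< c _ t<c)) (+-identityʳ _))

partitions : List ℕ → Seq
partitions []       = one
partitions (c ∷ cs) = multiples c ⋆ partitions cs

partitions-zero : ∀ cs → partitions cs 0 ≡ 1
partitions-zero []       = refl
partitions-zero (c ∷ cs) = cong₂ _*_ (multiples-∣ (c ∣0)) (partitions-zero cs)

partitions-swap : ∀ x y cs → partitions (x ∷ y ∷ cs) ≗ partitions (y ∷ x ∷ cs)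
partitions-swap x y cs =
  ≗-trans (≗-sym (⋆-assoc (multiples x) (multiples y) (partitions cs)))
  (≗-trans (⋆-cong (⋆-comm (multiples x) (multiples y)) (λ _ → refl))
           (⋆-assoc (multiples y) (multiples x) (partitions cs)))

partitions-↭ : ∀ {cs ds} → cs ↭ ds → partitions cs ≗ partitions ds
partitions-↭ ↭.refl          t = refl
partitions-↭ (↭.prep x p)    = ⋆-cong (λ _ → refl) (partitions-↭ p)
partitions-↭ {x ∷ y ∷ cs} (↭.swap x y p) =
  ≗-trans (partitions-swap x y cs) (⋆-cong (λ _ → refl) (⋆-cong (λ _ → refl) (partitions-↭ p)))
partitions-↭ (↭.trans p q)   = ≗-trans (partitions-↭ p) (partitions-↭ q)

partitions-+ : ∀ {c} → 0 < c → ∀ cs u →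
               partitions (c ∷ cs) (c + u) ≡ partitions cs (c + u) + partitions (c ∷ cs) u
partitions-+ c>0 cs = ⋆-multiples-+ c>0 (partitions cs)

recurrence-unique : ∀ {c} → 0 < c → {Q : ℕ → Set} → (∀ k → Q (c + k) → Q k) → ∀ {a u w : Seq} →
                    (∀ t → Q t → u t ≡ a t + shift c u t) → (∀ t → Q t → w t ≡ a t + shift c w t) →
                    ∀ t → Q t → u t ≡ w t
recurrence-unique {c} c>0 {Q} down {a} {u} {w} u-rec w-rec = <-rec (λ t → Q t → u t ≡ w t) step
  where
  step : ∀ t → (∀ {k} → k < t → Q k → u k ≡ w k) → Q t → u t ≡ w t
  step t ih qt with <-or-+ c t
  ... | inj₁ t<c = begin
    u t                  ≡⟨ u-rec t qt ⟩
    a t + shift c u t    ≡⟨ cong (a t +_) (trans (shift-< c u t<c) (sym (shift-< c w t<c))) ⟩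
    a t + shift c w t    ≡⟨ w-rec t qt ⟨
    w t                  ∎
    where open ≡-Reasoning
  ... | inj₂ (k , t≡c+k) rewrite t≡c+k = begin
    u (c + k)                  ≡⟨ u-rec (c + k) qt ⟩
    a (c + k) + shift c u (c + k) ≡⟨ cong (a (c + k) +_) shifts-agree ⟩
    a (c + k) + shift c w (c + k) ≡⟨ w-rec (c + k) qt ⟨
    w (c + k)                  ∎
    where
    open ≡-Reasoning
    shifts-agree : shift c u (c + k) ≡ shift c w (c + k)
    shifts-agree = trans (shift-+ c u k) (trans (ih (m<n+m k c>0) (down k qt)) (sym (shift-+ c w k)))

-- Counting solutions of a · x = t

∑ : ∀ {A : Set} → (A → ℕ) → List A → ℕ
∑ g []       = 0
∑ g (x ∷ xs) = g x + ∑ g xs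

∑-++ : ∀ {A : Set} (g : A → ℕ) xs ys → ∑ g (xs ++ ys) ≡ ∑ g xs + ∑ g ys
∑-++ g []       ys = refl
∑-++ g (x ∷ xs) ys = trans (cong (g x +_) (∑-++ g xs ys)) (sym (+-assoc (g x) _ _))

∑-concatMap : ∀ {A B : Set} (g : B → ℕ) (h : A → List B) xs → ∑ g (concatMap h xs) ≡ ∑ (∑ g ∘ h) xs
∑-concatMap g h []       = refl
∑-concatMap g h (x ∷ xs) = trans (∑-++ g (h x) (concat (map h xs))) (cong (∑ g (h x) +_) (∑-concatMap g h xs))

∑-map : ∀ {A B : Set} (g : B → ℕ) (h : A → B) xs → ∑ g (map h xs) ≡ ∑ (g ∘ h) xs
∑-map g h []       = refl
∑-map g h (x ∷ xs) = cong (g (h x) +_) (∑-map g h xs)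

∑-cong : ∀ {A : Set} {g h : A → ℕ} → (∀ x → g x ≡ h x) → ∀ xs → ∑ g xs ≡ ∑ h xs
∑-cong e []       = refl
∑-cong e (x ∷ xs) = cong₂ _+_ (e x) (∑-cong e xs)

∑-zero : ∀ {A : Set} {g : A → ℕ} → (∀ x → g x ≡ 0) → ∀ xs → ∑ g xs ≡ 0
∑-zero e []       = refl
∑-zero e (x ∷ xs) = cong₂ _+_ (e x) (∑-zero e xs)

∑-applyUpTo : ∀ (h g : ℕ → ℕ) n → ∑ g (applyUpTo h n) ≡ ∑ (g ∘ h) (upTo n)
∑-applyUpTo h g zero    = refl
∑-applyUpTo h g (suc n) =
  cong (g (h 0) +_) (trans (∑-applyUpTo (h ∘ suc) g n) (sym (∑-applyUpTo suc (g ∘ h) n)))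

∑-↭ : ∀ {A : Set} (g : A → ℕ) {xs ys} → xs ↭ ys → ∑ g xs ≡ ∑ g ys
∑-↭ g ↭.refl                        = refl
∑-↭ g (↭.prep x p)                  = cong (g x +_) (∑-↭ g p)
∑-↭ g (↭.swap {xs} {ys} x y p)      = trans (swap-front (g x) (g y) (∑ g xs)) (cong (λ z → g y + (g x + z)) (∑-↭ g p))
  where
  swap-front : ∀ a b c → a + (b + c) ≡ b + (a + c)
  swap-front = solve-∀
∑-↭ g (↭.trans p q)                 = trans (∑-↭ g p) (∑-↭ g q)

indicator : {A : Set} {P : Pred A 0ℓ} → Decidable P → A → ℕ
indicator P? x with does (P? x)
... | true  = 1
... | false = 0

indicator-≤1 : ∀ {A : Set} {P : Pred A 0ℓ} (P? : Decidable P) x → indicator P? x ≤ 1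
indicator-≤1 P? x with does (P? x)
... | true  = ≤-refl
... | false = z≤n

length-filter≡∑ : ∀ {A : Set} {P : Pred A 0ℓ} (P? : Decidable P) xs → length (filter P? xs) ≡ ∑ (indicator P?) xs
length-filter≡∑ P? []       = refl
length-filter≡∑ P? (x ∷ xs) with does (P? x)
... | true  = cong suc (length-filter≡∑ P? xs)
... | false = length-filter≡∑ P? xs

indicator-yes : ∀ {A : Set} {P : Pred A 0ℓ} (P? : Decidable P) {x} → P x → indicator P? x ≡ 1
indicator-yes P? {x} px with P? x
... | yes _   = refl
... | no ¬px = ⊥-elim (¬px px)

indicator-no : ∀ {A : Set} {P : Pred A 0ℓ} (P? : Decidable P) {x} → ¬ P x → indicator P? x ≡ 0
indicator-no P? {x} ¬px with P? x
... | yes px = ⊥-elim (¬px px)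
... | no _   = refl

isValue : ℕ → ℕ → ℕ
isValue u = indicator (_≟ u)

indicator-≟ : ∀ {A : Set} (h : A → ℕ) u x → indicator (λ y → h y ≟ u) x ≡ isValue u (h x)
indicator-≟ h u x with h x ≟ u
... | yes hx≡u = trans (indicator-yes (λ y → h y ≟ u) hx≡u) (sym (indicator-yes (_≟ u) hx≡u))
... | no hx≢u  = trans (indicator-no (λ y → h y ≟ u) hx≢u) (sym (indicator-no (_≟ u) hx≢u))

isValue-+ : ∀ {u m} w → m ≤ u → isValue u (m + w) ≡ isValue (u ∸ m) w
isValue-+ {u} {m} w m≤u with w ≟ u ∸ m
... | yes w≡u∸m = trans (indicator-yes (_≟ u) (trans (cong (m +_) w≡u∸m) (m+[n∸m]≡n m≤u)))
                        (sym (indicator-yes (_≟ u ∸ m) w≡u∸m))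
... | no w≢u∸m  = trans (indicator-no (_≟ u) (λ m+w≡u → w≢u∸m (trans (sym (m+n∸m≡n m w)) (cong (_∸ m) m+w≡u))))
                        (sym (indicator-no (_≟ u ∸ m) w≢u∸m))

isValue-> : ∀ {u m} w → ¬ m ≤ u → isValue u (m + w) ≡ 0
isValue-> {u} {m} w m≰u = indicator-no (_≟ u) (λ m+w≡u → m≰u (subst (m ≤_) m+w≡u (m≤m+n m w)))

dot-suc : ∀ {n} (c b : Fin (suc n) → ℕ) → dot c b ≡ c zero * b zero + dot (c ∘ suc) (b ∘ suc)
dot-suc c b = cong (c zero * b zero +_)
  (trans (cong sum (map-tabulate suc (λ i → c i * b i)))
         (sym (cong sum (map-tabulate id (λ i → c (suc i) * b (suc i))))))

dot-zeroʳ : ∀ {n} (c : Fin n → ℕ) → dot c (λ _ → 0) ≡ 0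
dot-zeroʳ {zero}  c = refl
dot-zeroʳ {suc n} c = trans (dot-suc c (λ _ → 0)) (cong₂ _+_ (*-zeroʳ (c zero)) (dot-zeroʳ (c ∘ suc)))

∣dot : ∀ {n} {d} (c b : Fin n → ℕ) → (∀ j → d ∣ c j) → d ∣ dot c b
∣dot {zero} {d}  c b d∣c = d ∣0
∣dot {suc n} {d} c b d∣c = subst (d ∣_) (sym (dot-suc c b))
  (∣m∣n⇒∣m+n (∣m⇒∣m*n (b zero) (d∣c zero)) (∣dot (c ∘ suc) (b ∘ suc) (d∣c ∘ suc)))

dot-monoʳ-≤ : ∀ {n} (c : Fin n → ℕ) {b b′ : Fin n → ℕ} → (∀ i → b i ≤ b′ i) → dot c b ≤ dot c b′
dot-monoʳ-≤ {zero}  c b≤b′ = z≤n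
dot-monoʳ-≤ {suc n} c {b} {b′} b≤b′ = subst₂ _≤_ (sym (dot-suc c b)) (sym (dot-suc c b′))
  (+-mono-≤ (*-monoʳ-≤ (c zero) (b≤b′ zero)) (dot-monoʳ-≤ (c ∘ suc) (b≤b′ ∘ suc)))

-- The summand of (multiples c ⋆ G) u indexed by the multiplicity x of c.
summand : ℕ → Seq → ℕ → ℕ → ℕ
summand c G u x with c * x ≤? u
... | yes _ = G (u ∸ c * x)
... | no _  = 0

summand-≤ : ∀ c G {u} x → c * x ≤ u → summand c G u x ≡ G (u ∸ c * x)
summand-≤ c G {u} x cx≤u with c * x ≤? u
... | yes _    = refl
... | no cx≰u = ⊥-elim (cx≰u cx≤u)

summand-> : ∀ c G {u} x → ¬ c * x ≤ u → summand c G u x ≡ 0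
summand-> c G {u} x cx≰u with c * x ≤? u
... | yes cx≤u = ⊥-elim (cx≰u cx≤u)
... | no _     = refl

summand-0 : ∀ c G u → summand c G u 0 ≡ G u
summand-0 c G u = trans (summand-≤ c G 0 (subst (_≤ u) (sym (*-zeroʳ c)) z≤n)) (cong (λ z → G (u ∸ z)) (*-zeroʳ c))

summand-< : ∀ c G {u} x → u < c → summand c G u (suc x) ≡ 0
summand-< c G {u} x u<c = summand-> c G (suc x) (λ c[1+x]≤u → <⇒≱ u<c (≤-trans c≤c[1+x] c[1+x]≤u))
  where
  c≤c[1+x] : c ≤ c * suc x
  c≤c[1+x] = subst (c ≤_) (sym (*-suc c x)) (m≤m+n c (c * x))

summand-+ : ∀ c G k x → summand c G (c + k) (suc x) ≡ summand c G k x
summand-+ c G k x with c * x ≤? k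
... | yes cx≤k = trans (summand-≤ c G (suc x) (subst (_≤ c + k) (sym (*-suc c x)) (+-monoʳ-≤ c cx≤k)))
                       (cong G (trans (cong (c + k ∸_) (*-suc c x)) ([m+n]∸[m+o]≡n∸o c k (c * x))))
... | no cx≰k  = summand-> c G (suc x) (λ h → cx≰k (+-cancelˡ-≤ c _ _ (subst (_≤ c + k) (*-suc c x) h)))

∑-summand : ∀ {c} → 0 < c → ∀ G B {u} → u ≤ B → ∑ (summand c G u) (upTo (suc B)) ≡ (multiples c ⋆ G) u
∑-summand {c} c>0 G zero {zero} z≤n =
  trans (+-identityʳ _) (trans (summand-0 c G 0) (sym (trans (cong (_* G 0) (multiples-∣ (c ∣0))) (*-identityˡ _))))
∑-summand {c} c>0 G (suc B) {u} u≤B with <-or-+ c u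
... | inj₁ u<c = begin
  summand c G u 0 + ∑ (summand c G u) (applyUpTo suc (suc B))
    ≡⟨ cong₂ _+_ (summand-0 c G u) (trans (∑-applyUpTo suc _ (suc B)) (∑-zero (λ x → summand-< c G x u<c) (upTo (suc B)))) ⟩
  G u + 0
    ≡⟨ +-identityʳ _ ⟩
  G u
    ≡⟨ ⋆-multiples-< c>0 G u<c ⟨
  (multiples c ⋆ G) u ∎
  where open ≡-Reasoning
... | inj₂ (k , u≡c+k) rewrite u≡c+k = begin
  summand c G (c + k) 0 + ∑ (summand c G (c + k)) (applyUpTo suc (suc B))
    ≡⟨ cong₂ _+_ (summand-0 c G (c + k))
         (trans (∑-applyUpTo suc _ (suc B)) (∑-cong (summand-+ c G k) (upTo (suc B)))) ⟩
  G (c + k) + ∑ (summand c G k) (upTo (suc B))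
    ≡⟨ cong (G (c + k) +_) (∑-summand c>0 G B (≤-pred (≤-trans (+-monoˡ-≤ k c>0) u≤B))) ⟩
  G (c + k) + (multiples c ⋆ G) k
    ≡⟨ ⋆-multiples-+ c>0 G k ⟨
  (multiples c ⋆ G) (c + k) ∎
  where open ≡-Reasoning

solutionsIn : ∀ n → (Fin n → ℕ) → ℕ → ℕ → ℕ
solutionsIn n a B u = ∑ (indicator (λ x → dot a (lookup x) ≟ u)) (box n B)

solutionsIn≡partitions : ∀ n (a : Fin n → ℕ) B {u} → (∀ i → 0 < a i) → u ≤ B →
                         solutionsIn n a B u ≡ partitions (tabulate a) u
solutionsIn≡partitions zero    a B {zero}  _   _ = indicator-yes (λ x → dot a (lookup x) ≟ 0) {Data.Vec.[]} refl
solutionsIn≡partitions zero    a B {suc u} _   _ = indicator-no (λ x → dot a (lookup x) ≟ suc u) {Data.Vec.[]} (λ ())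
solutionsIn≡partitions (suc n) a B {u} a>0 u≤B =
  trans (∑-concatMap _ (λ x → map (x Data.Vec.∷_) (box n B)) (upTo (suc B)))
  (trans (∑-cong byFirst (upTo (suc B)))
         (∑-summand (a>0 zero) G B u≤B))
  where
  G = partitions (tabulate (a ∘ suc))
  byFirst : ∀ x → ∑ (indicator (λ y → dot a (lookup y) ≟ u)) (map (x Data.Vec.∷_) (box n B))
                  ≡ summand (a zero) G u x
  byFirst x = trans (∑-map _ (x Data.Vec.∷_) (box n B))
    (trans (∑-cong (λ v → trans (indicator-≟ (λ y → dot a (lookup y)) u (x Data.Vec.∷ v))
                                (cong (isValue u) (dot-suc a (lookup (x Data.Vec.∷ v))))) (box n B))
           (split (a zero * x ≤? u)))
    where
    split : Dec (a zero * x ≤ u) →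
            ∑ (λ v → isValue u (a zero * x + dot (a ∘ suc) (lookup v))) (box n B) ≡ summand (a zero) G u x
    split (yes ax≤u) =
      trans (∑-cong (λ v → trans (isValue-+ _ ax≤u) (sym (indicator-≟ (λ y → dot (a ∘ suc) (lookup y)) (u ∸ a zero * x) v)))
                    (box n B))
      (trans (solutionsIn≡partitions n (a ∘ suc) B (a>0 ∘ suc) (≤-trans (m∸n≤m u (a zero * x)) u≤B))
             (sym (summand-≤ (a zero) G x ax≤u)))
    split (no ax≰u) = trans (∑-zero (λ v → isValue-> _ ax≰u) (box n B)) (sym (summand-> (a zero) G x ax≰u))

f≡partitions : ∀ {n} (a : Fin n → ℕ) → (∀ i → 0 < a i) → ∀ t → f a t ≡ partitions (tabulate a) t
f≡partitions {n} a a>0 t =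
  trans (length-filter≡∑ (λ x → dot a (lookup x) ≟ t) (box n t)) (solutionsIn≡partitions n a t a>0 ≤-refl)

-- Congruences and the sieve

∣m+n∣n⇒∣m : ∀ {d m n} → d ∣ m + n → d ∣ n → d ∣ m
∣m+n∣n⇒∣m {d} {m} {n} d∣m+n d∣n = ∣m+n∣m⇒∣n (subst (d ∣_) (+-comm m n) d∣m+n) d∣n

infix 4 _≡_[mod_]

-- x ≡ y (mod m), stated without subtraction.
record _≡_[mod_] (x y m : ℕ) : Set where
  constructor congruent
  field
    k k′ : ℕ
    eq   : x + m * k ≡ y + m * k′

≡mod-refl : ∀ {m x} → x ≡ x [mod m ]
≡mod-refl = congruent 0 0 refl

≡mod-sym : ∀ {m x y} → x ≡ y [mod m ] → y ≡ x [mod m ]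
≡mod-sym (congruent a a′ eq) = congruent a′ a (sym eq)

≡mod-trans : ∀ {m x y z} → x ≡ y [mod m ] → y ≡ z [mod m ] → x ≡ z [mod m ]
≡mod-trans {m} {x} {y} {z} (congruent a a′ x≡y) (congruent b b′ y≡z) = congruent (a + b) (b′ + a′) (begin
  x + m * (a + b)        ≡⟨ reassoc x m a b ⟩
  (x + m * a) + m * b    ≡⟨ cong (_+ m * b) x≡y ⟩
  (y + m * a′) + m * b   ≡⟨ swap y (m * a′) (m * b) ⟩
  (y + m * b) + m * a′   ≡⟨ cong (_+ m * a′) y≡z ⟩
  (z + m * b′) + m * a′  ≡⟨ reassoc z m b′ a′ ⟨
  z + m * (b′ + a′)      ∎)
  where
  open ≡-Reasoning
  reassoc : ∀ x m a b → x + m * (a + b) ≡ (x + m * a) + m * b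
  reassoc = solve-∀
  swap : ∀ x y z → x + y + z ≡ x + z + y
  swap = solve-∀

≡mod-+ : ∀ {m x y x′ y′} → x ≡ y [mod m ] → x′ ≡ y′ [mod m ] → x + x′ ≡ y + y′ [mod m ]
≡mod-+ {m} {x} {y} {x′} {y′} (congruent a a′ e) (congruent b b′ e′) = congruent (a + b) (a′ + b′) (begin
  x + x′ + m * (a + b)         ≡⟨ interchange x x′ m a b ⟩
  (x + m * a) + (x′ + m * b)   ≡⟨ cong₂ _+_ e e′ ⟩
  (y + m * a′) + (y′ + m * b′) ≡⟨ interchange y y′ m a′ b′ ⟨
  y + y′ + m * (a′ + b′)       ∎)
  where
  open ≡-Reasoning
  interchange : ∀ x x′ m a b → x + x′ + m * (a + b) ≡ (x + m * a) + (x′ + m * b)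
  interchange = solve-∀

≡mod-*ˡ : ∀ {m x y} k → x ≡ y [mod m ] → k * x ≡ k * y [mod m ]
≡mod-*ˡ {m} {x} {y} k (congruent a a′ e) = congruent (k * a) (k * a′) (begin
  k * x + m * (k * a)   ≡⟨ factor k x m a ⟩
  k * (x + m * a)       ≡⟨ cong (k *_) e ⟩
  k * (y + m * a′)      ≡⟨ factor k y m a′ ⟨
  k * y + m * (k * a′)  ∎)
  where
  open ≡-Reasoning
  factor : ∀ k x m a → k * x + m * (k * a) ≡ k * (x + m * a)
  factor = solve-∀

≡mod-cancelˡ : ∀ {m} x {y z} → x + y ≡ x + z [mod m ] → y ≡ z [mod m ]
≡mod-cancelˡ {m} x {y} {z} (congruent a a′ e) =
  congruent a a′ (+-cancelˡ-≡ x _ _ (trans (sym (+-assoc x y (m * a))) (trans e (+-assoc x z (m * a′)))))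

∣⇒+≡mod : ∀ {m x} y → m ∣ x → x + y ≡ y [mod m ]
∣⇒+≡mod {m} y (divides q refl) = congruent 0 q (rearrange q m y)
  where
  rearrange : ∀ q m y → q * m + y + m * 0 ≡ y + m * q
  rearrange = solve-∀

∣⇒≡mod0 : ∀ {m x} → m ∣ x → x ≡ 0 [mod m ]
∣⇒≡mod0 {m} {x} m∣x = subst (_≡ 0 [mod m ]) (+-identityʳ x) (∣⇒+≡mod 0 m∣x)

≡mod-dropˡ : ∀ {m k x y} → m ∣ k → k + x ≡ y [mod m ] → x ≡ y [mod m ]
≡mod-dropˡ {x = x} m∣k = ≡mod-trans (≡mod-sym (∣⇒+≡mod x m∣k))

≡mod-dropʳ : ∀ {m t u r} → m ∣ r → t ≡ u + r [mod m ] → t ≡ u [mod m ]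
≡mod-dropʳ {m} {t} {u} {r} m∣r e = ≡mod-trans e (subst (_≡ u [mod m ]) (+-comm r u) (∣⇒+≡mod u m∣r))

≡mod-∣ : ∀ {m x y} → x ≡ y [mod m ] → m ∣ y → m ∣ x
≡mod-∣ {m} (congruent a a′ e) m∣y =
  ∣m+n∣n⇒∣m (subst (m ∣_) (sym e) (∣m∣n⇒∣m+n m∣y (∣m⇒∣m*n a′ ∣-refl))) (∣m⇒∣m*n a ∣-refl)

≡mod-% : ∀ x m .{{_ : NonZero m}} → x % m ≡ x [mod m ]
≡mod-% x m = congruent (x / m) 0 (begin
  x % m + m * (x / m)  ≡⟨ cong (x % m +_) (*-comm m (x / m)) ⟩
  x % m + x / m * m    ≡⟨ m≡m%n+[m/n]*n x m ⟨
  x                    ≡⟨ +-identityʳ x ⟨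
  x + 0                ≡⟨ cong (x +_) (*-zeroʳ m) ⟨
  x + m * 0            ∎)
  where open ≡-Reasoning

≡mod⇒∣∸ : ∀ {m r t} → r ≤ t → r ≡ t [mod m ] → m ∣ t ∸ r
≡mod⇒∣∸ {m} {r} {t} r≤t (congruent k k′ e) =
  ∣m+n∣n⇒∣m (subst (m ∣_) mk≡ (∣m⇒∣m*n k ∣-refl)) (∣m⇒∣m*n k′ ∣-refl)
  where
  mk≡ : m * k ≡ (t ∸ r) + m * k′
  mk≡ = +-cancelˡ-≡ r _ _ (trans e (trans (cong (_+ m * k′) (sym (m+[n∸m]≡n r≤t))) (+-assoc r (t ∸ r) _)))

inverse-mod : ∀ {m a} → 0 < m → Coprime m a → ∃ λ u → a * u ≡ 1 [mod m ]
inverse-mod {m} {a} m>0 m⊥a with coprime-Bézout m⊥a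
... | Bézout.-+ x y eq =
  y , congruent 0 x (trans (+-identityʳ' (a * y)) (trans (*-comm a y) (trans (sym eq) (cong suc (*-comm x m)))))
  where
  +-identityʳ' : ∀ n → n + m * 0 ≡ n
  +-identityʳ' n = trans (cong (n +_) (*-zeroʳ m)) (+-identityʳ n)
inverse-mod {suc m′} {a} _ _ | Bézout.+- x y eq = y * m′ , congruent 1 (x * m′) (begin
  a * (y * m′) + suc m′ * 1   ≡⟨ expand a y m′ ⟩
  (1 + y * a) * m′ + 1        ≡⟨ cong (λ z → z * m′ + 1) eq ⟩
  x * suc m′ * m′ + 1         ≡⟨ collect x m′ ⟩
  1 + suc m′ * (x * m′)       ∎)
  where
  open ≡-Reasoning
  expand : ∀ a y m′ → a * (y * m′) + suc m′ * 1 ≡ (1 + y * a) * m′ + 1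
  expand = solve-∀
  collect : ∀ x m′ → x * suc m′ * m′ + 1 ≡ 1 + suc m′ * (x * m′)
  collect = solve-∀

≡mod-inverse : ∀ {m a u b t} → a * u ≡ 1 [mod m ] → b ≡ t * u [mod m ] → a * b ≡ t [mod m ]
≡mod-inverse {m} {a} {u} {b} {t} au≡1 b≡tu =
  ≡mod-trans (≡mod-*ˡ a b≡tu)
    (subst₂ (_≡_[mod m ]) (*-comm-middle t a u) (*-identityʳ t) (≡mod-*ˡ t au≡1))
  where
  *-comm-middle : ∀ x y z → x * (y * z) ≡ y * (x * z)
  *-comm-middle = solve-∀

dot-≡mod : ∀ {n m} (c b : Fin n → ℕ) i → (∀ j → j ≢ i → m ∣ c j) → dot c b ≡ c i * b i [mod m ]
dot-≡mod {suc n} {m} c b zero m∣c =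
  subst₂ (_≡_[mod m ]) (sym (dot-suc c b)) (+-identityʳ _)
    (≡mod-+ ≡mod-refl (∣⇒≡mod0 (∣dot (c ∘ suc) (b ∘ suc) (λ j → m∣c (suc j) (λ ())))))
dot-≡mod {suc n} {m} c b (suc i) m∣c =
  subst (_≡ c (suc i) * b (suc i) [mod m ]) (sym (dot-suc c b))
    (≡mod-+ (∣⇒≡mod0 (∣m⇒∣m*n (b zero) (m∣c zero (λ ()))))
            (dot-≡mod (c ∘ suc) (b ∘ suc) i (λ j j≢i → m∣c (suc j) (j≢i ∘ Fin.suc-injective))))

-- For v supported on multiples of m ⊥ c, the series U = v / (1 − zᶜ) restricted to the residue
-- class of c b modulo m is v / (1 − z^(c m)) shifted by c b.
module Sieve {c m : ℕ} (c>0 : 0 < c) (m>0 : 0 < m) (m⊥c : Coprime m c)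
             (v : Seq) (v-supp : ∀ {t} → ¬ m ∣ t → v t ≡ 0) where

  U : Seq
  U = multiples c ⋆ v

  m∤c*b : ∀ {b} → 0 < b → b < m → ¬ m ∣ c * b
  m∤c*b b>0 b<m m∣cb = <⇒≱ b<m (∣⇒≤ {{>-nonZero b>0}} (coprime-divisor m⊥c m∣cb))

  U-+c*b : ∀ {b y} → b < m → m ∣ y → U (c * b + y) ≡ U y
  U-+c*b {zero}  {y} _   _   = cong (λ z → U (z + y)) (*-zeroʳ c)
  U-+c*b {suc b} {y} b<m m∣y = begin
    U (c * suc b + y)          ≡⟨ cong U c*[1+b]+y≡ ⟩
    U (c + (c * b + y))        ≡⟨ ⋆-multiples-+ c>0 v (c * b + y) ⟩
    v (c + (c * b + y)) + U (c * b + y)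
      ≡⟨ cong₂ _+_ (v-supp (λ m∣ → m∤c*b (s≤s z≤n) b<m (∣m+n∣n⇒∣m (subst (m ∣_) (sym c*[1+b]+y≡) m∣) m∣y)))
                   (U-+c*b (<-trans (n<1+n b) b<m) m∣y) ⟩
    0 + U y                    ∎
    where
    open ≡-Reasoning
    c*[1+b]+y≡ : c * suc b + y ≡ c + (c * b + y)
    c*[1+b]+y≡ = trans (cong (_+ y) (*-suc c b)) (+-assoc c (c * b) y)

  U-below : ∀ {b t} → b < m → t < c * b → t ≡ c * b [mod m ] → U t ≡ 0
  U-below {zero}  {t} _   t<0 _ = ⊥-elim (<⇒≱ t<0 (subst (_≤ t) (sym (*-zeroʳ c)) z≤n))
  U-below {suc b} {t} b<m t<cb t≡cb with <-or-+ c t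
  ... | inj₁ t<c = trans (⋆-multiples-< c>0 v t<c) v-t≡0
    where
    v-t≡0 : v t ≡ 0
    v-t≡0 = v-supp (λ m∣t → m∤c*b (s≤s z≤n) b<m (≡mod-∣ (≡mod-sym t≡cb) m∣t))
  ... | inj₂ (k , t≡c+k) rewrite t≡c+k =
    trans (⋆-multiples-+ c>0 v k) (cong₂ _+_ v-t≡0 (U-below (<-trans (n<1+n b) b<m) k<cb k≡cb))
    where
    v-t≡0 : v (c + k) ≡ 0
    v-t≡0 = v-supp (λ m∣t → m∤c*b (s≤s z≤n) b<m (≡mod-∣ (≡mod-sym t≡cb) m∣t))
    k<cb : k < c * b
    k<cb = +-cancelˡ-< c k (c * b) (subst (c + k <_) (*-suc c b) t<cb)
    k≡cb : k ≡ c * b [mod m ]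
    k≡cb = ≡mod-cancelˡ c (subst (c + k ≡_[mod m ]) (*-suc c b) t≡cb)

  cm>0 : 0 < c * m
  cm>0 = *-mono-≤ c>0 m>0

  c*m≡c+c*pred : c * m ≡ c + c * pred m
  c*m≡c+c*pred = trans (cong (c *_) (sym (suc-pred m {{>-nonZero m>0}}))) (*-suc c (pred m))

  pred-m<m : pred m < m
  pred-m<m = subst (pred m <_) (suc-pred m {{>-nonZero m>0}}) (n<1+n (pred m))

  -- shift c U y = U (y − c) equals U (y − c m): for y < c m it vanishes by U-below, and otherwise
  -- y − c = c (m − 1) + (y − c m).
  U-rec : ∀ {y} → m ∣ y → U y ≡ v y + shift (c * m) U y
  U-rec {y} m∣y = trans (⋆-multiples-rec c>0 v y) (cong (v y +_) shift-c≡shift-cm)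
    where
    shift-c≡shift-cm : shift c U y ≡ shift (c * m) U y
    shift-c≡shift-cm with <-or-+ (c * m) y | <-or-+ c y
    ... | inj₁ y<cm | inj₁ y<c = trans (shift-< c U y<c) (sym (shift-< (c * m) U y<cm))
    ... | inj₁ y<cm | inj₂ (k , y≡c+k) rewrite y≡c+k =
      trans (shift-+ c U k) (trans (U-below pred-m<m k<c*pred k≡c*pred) (sym (shift-< (c * m) U y<cm)))
      where
      k<c*pred : k < c * pred m
      k<c*pred = +-cancelˡ-< c k _ (subst (c + k <_) c*m≡c+c*pred y<cm)
      k≡c*pred : k ≡ c * pred m [mod m ]
      k≡c*pred = ≡mod-cancelˡ c (≡mod-trans (∣⇒≡mod0 m∣y)
                   (≡mod-sym (∣⇒≡mod0 (subst (m ∣_) c*m≡c+c*pred (n∣m*n c)))))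
    ... | inj₂ (k , y≡cm+k) | _ rewrite y≡cm+k = begin
      shift c U (c * m + k)            ≡⟨ cong (shift c U) (trans (cong (_+ k) c*m≡c+c*pred) (+-assoc c _ k)) ⟩
      shift c U (c + (c * pred m + k)) ≡⟨ shift-+ c U _ ⟩
      U (c * pred m + k)               ≡⟨ U-+c*b pred-m<m (∣m+n∣m⇒∣n m∣y (n∣m*n c)) ⟩
      U k                              ≡⟨ shift-+ (c * m) U k ⟨
      shift (c * m) U (c * m + k)      ∎
      where open ≡-Reasoning

  U≡ : ∀ (w : Seq) {Q : ℕ → Set} → (∀ {y} → Q y → m ∣ y) → (∀ k → Q (c * m + k) → Q k) →
       (∀ {y} → Q y → v y ≡ w y) → ∀ y → Q y → U y ≡ (multiples (c * m) ⋆ w) y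
  U≡ w Q⇒m∣ Q-down v≡w = recurrence-unique cm>0 Q-down
    (λ t qt → U-rec (Q⇒m∣ qt))
    (λ t qt → trans (⋆-multiples-rec cm>0 w t) (cong (_+ _) (sym (v≡w qt))))

partitions-supp : ∀ {n d} (c : Fin n → ℕ) → (∀ i → d ∣ c i) → ∀ {t} → ¬ d ∣ t →
                  partitions (tabulate c) t ≡ 0
partitions-supp {zero}      c d∣c {zero}  d∤t = ⊥-elim (d∤t (_ ∣0))
partitions-supp {zero}      c d∣c {suc t} d∤t = refl
partitions-supp {suc n} {d} c d∣c {t}     d∤t = ⋆-vanish _ _ t vanish
  where
  vanish : ∀ i j → i + j ≡ t → multiples (c zero) i ≡ 0 ⊎ partitions (tabulate (c ∘ suc)) j ≡ 0
  vanish i j i+j≡t = by (c zero ∣? i)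
    where
    by : Dec (c zero ∣ i) → multiples (c zero) i ≡ 0 ⊎ partitions (tabulate (c ∘ suc)) j ≡ 0
    by (no c₀∤i)  = inj₁ (multiples-∤ c₀∤i)
    by (yes c₀∣i) = inj₂ (partitions-supp (c ∘ suc) (d∣c ∘ suc)
                      (λ d∣j → d∤t (subst (d ∣_) i+j≡t (∣m∣n⇒∣m+n (∣-trans (d∣c zero) c₀∣i) d∣j))))

-- The first generator is sieved with modulus m zero, the others by induction.
partitions-sieve : ∀ n (c m b : Fin n → ℕ) →
  (∀ i → 0 < c i) → (∀ i → 0 < m i) → (∀ i j → i ≢ j → m i ∣ c j) → (∀ i → Coprime (m i) (c i)) →
  (∀ i → b i < m i) → ∀ t → (∀ i → t ≡ dot c b [mod m i ]) →
  partitions (tabulate c) t ≡ shift (dot c b) (partitions (tabulate (λ i → c i * m i))) t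
partitions-sieve zero    c m b _ _ _ _ _ t _ = refl
partitions-sieve (suc n) c m b c>0 m>0 m∣c m⊥c b<m t t≡cb = split (<-or-+ (c₀ * b₀) t)
  where
  c₀ = c zero
  m₀ = m zero
  b₀ = b zero
  rest = dot (c ∘ suc) (b ∘ suc)
  G = partitions (tabulate (λ i → c (suc i) * m (suc i)))

  m₀∣c′ : ∀ j → m₀ ∣ c (suc j)
  m₀∣c′ j = m∣c zero (suc j) (λ ())

  m₀∣rest : m₀ ∣ rest
  m₀∣rest = ∣dot (c ∘ suc) (b ∘ suc) m₀∣c′

  t≡c₀b₀+rest : ∀ i → t ≡ c₀ * b₀ + rest [mod m i ]
  t≡c₀b₀+rest i = subst (t ≡_[mod m i ]) (dot-suc c b) (t≡cb i)

  open Sieve (c>0 zero) (m>0 zero) (m⊥c zero) (partitions (tabulate (c ∘ suc))) (partitions-supp (c ∘ suc) m₀∣c′)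

  Q : ℕ → Set
  Q x = m₀ ∣ x × (∀ i → x ≡ rest [mod m (suc i) ])

  Q-down : ∀ k → Q (c₀ * m₀ + k) → Q k
  Q-down k (m₀∣ , ≡rest) =
    ∣m+n∣m⇒∣n m₀∣ (n∣m*n c₀) , λ i → ≡mod-dropˡ (∣m⇒∣m*n m₀ (m∣c (suc i) zero (λ ()))) (≡rest i)

  by-induction : ∀ {y} → Q y → partitions (tabulate (c ∘ suc)) y ≡ shift rest G y
  by-induction {y} (_ , ≡rest) = partitions-sieve n (c ∘ suc) (m ∘ suc) (b ∘ suc) (c>0 ∘ suc) (m>0 ∘ suc)
    (λ i j i≢j → m∣c (suc i) (suc j) (i≢j ∘ Fin.suc-injective)) (m⊥c ∘ suc) (b<m ∘ suc) y ≡rest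

  shift-dot : ∀ y → shift (dot c b) (partitions (tabulate (λ i → c i * m i))) (c₀ * b₀ + y)
                    ≡ (multiples (c₀ * m₀) ⋆ shift rest G) y
  shift-dot y = begin
    shift (dot c b) (multiples (c₀ * m₀) ⋆ G) (c₀ * b₀ + y)
      ≡⟨ cong (λ r → shift r (multiples (c₀ * m₀) ⋆ G) (c₀ * b₀ + y)) (dot-suc c b) ⟩
    shift (c₀ * b₀ + rest) (multiples (c₀ * m₀) ⋆ G) (c₀ * b₀ + y)
      ≡⟨ shift-shift (c₀ * b₀) rest _ _ ⟩
    shift (c₀ * b₀) (shift rest (multiples (c₀ * m₀) ⋆ G)) (c₀ * b₀ + y)
      ≡⟨ shift-+ (c₀ * b₀) _ y ⟩
    shift rest (multiples (c₀ * m₀) ⋆ G) y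
      ≡⟨ ⋆-shiftʳ rest (multiples (c₀ * m₀)) G y ⟨
    (multiples (c₀ * m₀) ⋆ shift rest G) y ∎
    where open ≡-Reasoning

  split : t < c₀ * b₀ ⊎ ∃ (λ y → t ≡ c₀ * b₀ + y) →
          partitions (tabulate c) t ≡ shift (dot c b) (partitions (tabulate (λ i → c i * m i))) t
  split (inj₁ t<c₀b₀) = trans (U-below (b<m zero) t<c₀b₀ (≡mod-dropʳ m₀∣rest (t≡c₀b₀+rest zero)))
    (sym (shift-< (dot c b) _ (<-≤-trans t<c₀b₀ (subst (c₀ * b₀ ≤_) (sym (dot-suc c b)) (m≤m+n _ _)))))
  split (inj₂ (y , t≡c₀b₀+y)) = begin
    U t                  ≡⟨ cong U t≡c₀b₀+y ⟩
    U (c₀ * b₀ + y)      ≡⟨ U-+c*b (b<m zero) m₀∣y ⟩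
    U y                  ≡⟨ U≡ (shift rest G) proj₁ Q-down by-induction y (m₀∣y , y≡rest) ⟩
    (multiples (c₀ * m₀) ⋆ shift rest G) y
                         ≡⟨ shift-dot y ⟨
    shift (dot c b) _ (c₀ * b₀ + y)
                         ≡⟨ cong (shift (dot c b) _) t≡c₀b₀+y ⟨
    shift (dot c b) _ t  ∎
    where
    open ≡-Reasoning
    y≡rest′ : ∀ i → y ≡ rest [mod m i ]
    y≡rest′ i = ≡mod-cancelˡ (c₀ * b₀) (subst (_≡ c₀ * b₀ + rest [mod m i ]) t≡c₀b₀+y (t≡c₀b₀+rest i))
    y≡rest : ∀ i → y ≡ rest [mod m (suc i) ]
    y≡rest = y≡rest′ ∘ suc
    m₀∣y : m₀ ∣ y
    m₀∣y = ≡mod-∣ (y≡rest′ zero) m₀∣rest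

shift-* : ∀ {p} → 0 < p → ∀ c X t → shift (p * c) X (p * t) ≡ shift c (X ∘ (p *_)) t
shift-* {p} p>0 c X t with <-or-+ c t
... | inj₁ t<c = trans (shift-< (p * c) X (*-monoʳ-< p {{>-nonZero p>0}} t<c)) (sym (shift-< c _ t<c))
... | inj₂ (k , t≡c+k) rewrite t≡c+k =
  trans (cong (shift (p * c) X) (*-distribˡ-+ p c k)) (trans (shift-+ (p * c) X (p * k)) (sym (shift-+ c _ k)))

⋆-multiples-scale : ∀ {p c} → 0 < p → 0 < c → ∀ {V W : Seq} → (∀ x → W (p * x) ≡ V x) →
                    ∀ s → (multiples (p * c) ⋆ W) (p * s) ≡ (multiples c ⋆ V) s
⋆-multiples-scale {p} {c} p>0 c>0 {V} {W} W∘p≡V s = recurrence-unique c>0 {λ _ → ⊤} (λ _ _ → tt)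
  (λ t _ → trans (⋆-multiples-rec (*-mono-≤ p>0 c>0) W (p * t)) (cong₂ _+_ (W∘p≡V t) (shift-* p>0 c _ t)))
  (λ t _ → ⋆-multiples-rec c>0 V t) s tt

Positive : List ℕ → Set
Positive = All (0 <_)

partitions-scale : ∀ {p} → 0 < p → ∀ {cs} → Positive cs → ∀ s → partitions (map (p *_) cs) (p * s) ≡ partitions cs s
partitions-scale {suc p} _ [] zero    = cong one (*-zeroʳ p)
partitions-scale {suc p} _ [] (suc s) = refl
partitions-scale p>0 (c>0 ∷ cs>0) = ⋆-multiples-scale p>0 c>0 (partitions-scale p>0 cs>0)

gcdL-∣ : ∀ {x} L → x ∈ L → gcdL L ∣ x
gcdL-∣ (y ∷ L) (here refl) = gcd[m,n]∣m y (gcdL L)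
gcdL-∣ (y ∷ L) (there x∈L) = ∣-trans (gcd[m,n]∣n y (gcdL L)) (gcdL-∣ L x∈L)

∣gcdL : ∀ {k} L → (∀ {x} → x ∈ L → k ∣ x) → k ∣ gcdL L
∣gcdL []      _  = _ ∣0
∣gcdL (y ∷ L) k∣ = gcd-greatest (k∣ (here refl)) (∣gcdL L (k∣ ∘ there))

coprime-* : ∀ {a b c} → Coprime a b → Coprime a c → Coprime a (b * c)
coprime-* a⊥b a⊥c {k} (k∣a , k∣bc) = a⊥c (k∣a , coprime-divisor k⊥b k∣bc)
  where
  k⊥b : Coprime k _
  k⊥b (j∣k , j∣b) = a⊥b (∣-trans j∣k k∣a , j∣b)

coprime⇒*∣ : ∀ {c d x} → Coprime c d → c ∣ x → d ∣ x → c * d ∣ x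
coprime⇒*∣ {c} {d} c⊥d c∣x d∣x = subst (_∣ _) c*d≡lcm (lcm-least c∣x d∣x)
  where
  c*d≡lcm : lcm c d ≡ c * d
  c*d≡lcm = trans (sym (*-identityˡ _)) (trans (cong (_* lcm c d) (sym (coprime⇒gcd≡1 c⊥d))) (gcd*lcm c d))

product-∣ : ∀ {A : Set} (d : A → ℕ) {x} {L : List A} → Unique L → (∀ {i j} → i ≢ j → Coprime (d i) (d j)) →
            (∀ {j} → j ∈ L → d j ∣ x) → product (map d L) ∣ x
product-∣ d {x} {[]}    _           _   _  = 1∣ x
product-∣ d {x} {j ∷ L} (j∉L ∷ uL) d⊥d d∣ =
  coprime⇒*∣ (d-coprime-product j∉L) (d∣ (here refl)) (product-∣ d uL d⊥d (d∣ ∘ there))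
  where
  d-coprime-product : ∀ {L} → All (j ≢_) L → Coprime (d j) (product (map d L))
  d-coprime-product []           = Coprime.sym (Coprime.1-coprimeTo (d j))
  d-coprime-product (j≢k ∷ j≢L) = coprime-* (d⊥d j≢k) (d-coprime-product j≢L)

≢? : ∀ {n} (i j : Fin n) → Dec (j ≢ i)
≢? i j = ¬? (j Fin.≟ i)

product-split : ∀ {n} (d : Fin n → ℕ) i {L} → Unique L → i ∈ L →
                product (map d L) ≡ d i * product (map d (filter (≢? i) L))
product-split d i {x ∷ L} (x∉L ∷ uL) i∈x∷L = by (x Fin.≟ i)
  where
  open ≡-Reasoning
  *-comm-middle : ∀ a b c → a * (b * c) ≡ b * (a * c)
  *-comm-middle = solve-∀
  by : Dec (x ≡ i) → product (map d (x ∷ L)) ≡ d i * product (map d (filter (≢? i) (x ∷ L)))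
  by (yes refl) = cong (λ l → d x * product (map d l))
    (sym (trans (filter-reject (≢? i) (λ x≢x → x≢x refl))
                (filter-all (≢? i) (All.map (λ x≢k k≡x → x≢k (sym k≡x)) x∉L))))
  by (no x≢i) = begin
    d x * product (map d L)                          ≡⟨ cong (d x *_) (product-split d i uL (i∈L i∈x∷L)) ⟩
    d x * (d i * product (map d (filter (≢? i) L)))  ≡⟨ *-comm-middle (d x) (d i) _ ⟩
    d i * (d x * product (map d (filter (≢? i) L)))  ≡⟨ cong (λ l → d i * product (map d l)) (filter-accept (≢? i) x≢i) ⟨
    d i * product (map d (filter (≢? i) (x ∷ L)))    ∎
    where
    i∈L : i ∈ x ∷ L → i ∈ L
    i∈L (here i≡x)  = ⊥-elim (x≢i (sym i≡x))
    i∈L (there i∈L) = i∈L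

-- Growth of partition counts

⋆-≤ : ∀ u v t {B} → (∀ i → u i ≤ 1) → (∀ j → j ≤ t → v j ≤ B) → (u ⋆ v) t ≤ suc t * B
⋆-≤ u v zero    {B} u≤1 v≤B =
  subst (u 0 * v 0 ≤_) (sym (+-identityʳ B)) (subst (u 0 * v 0 ≤_) (*-identityˡ B) (*-mono-≤ (u≤1 0) (v≤B 0 z≤n)))
⋆-≤ u v (suc t) {B} u≤1 v≤B =
  +-mono-≤ (subst (u 0 * v (suc t) ≤_) (*-identityˡ B) (*-mono-≤ (u≤1 0) (v≤B (suc t) ≤-refl)))
           (⋆-≤ (u ∘ suc) v t (u≤1 ∘ suc) (λ j j≤t → v≤B j (m≤n⇒m≤1+n j≤t)))

one≤1 : ∀ t → one t ≤ 1
one≤1 zero    = ≤-refl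
one≤1 (suc t) = z≤n

⋆-≥-term : ∀ u v {t k} → k ≤ t → u k * v (t ∸ k) ≤ (u ⋆ v) t
⋆-≥-term u v {zero}  {zero}  _         = ≤-refl
⋆-≥-term u v {suc t} {zero}  _         = m≤m+n _ _
⋆-≥-term u v {suc t} {suc k} (s≤s k≤t) = ≤-trans (⋆-≥-term (u ∘ suc) v k≤t) (m≤n+m _ _)

⋆-monoʳ-≤ : ∀ u {v v′} t → (∀ j → j ≤ t → v j ≤ v′ j) → (u ⋆ v) t ≤ (u ⋆ v′) t
⋆-monoʳ-≤ u zero    v≤v′ = *-monoʳ-≤ (u 0) (v≤v′ 0 z≤n)
⋆-monoʳ-≤ u (suc t) v≤v′ =
  +-mono-≤ (*-monoʳ-≤ (u 0) (v≤v′ (suc t) ≤-refl))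
           (⋆-monoʳ-≤ (u ∘ suc) t (λ j j≤t → v≤v′ j (m≤n⇒m≤1+n j≤t)))

⋆-≤-support : ∀ u v s {B M} → (∀ i → u i ≤ 1) → (∀ i → B ≤ i → u i ≡ 0) → (∀ j → j ≤ s → v j ≤ M) →
              (u ⋆ v) s ≤ B * M
⋆-≤-support u v zero    {zero}      u≤1 u≡0 v≤M = ≤-reflexive (cong (_* v 0) (u≡0 0 z≤n))
⋆-≤-support u v zero    {suc B} {M} u≤1 u≡0 v≤M =
  ≤-trans (subst (u 0 * v 0 ≤_) (*-identityˡ M) (*-mono-≤ (u≤1 0) (v≤M 0 z≤n))) (m≤m+n M (B * M))
⋆-≤-support u v (suc s) {zero}      u≤1 u≡0 v≤M = ≤-reflexive (⋆-vanish u v (suc s) (λ i _ _ → inj₁ (u≡0 i z≤n)))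
⋆-≤-support u v (suc s) {suc B} {M} u≤1 u≡0 v≤M =
  +-mono-≤ (subst (u 0 * v (suc s) ≤_) (*-identityˡ M) (*-mono-≤ (u≤1 0) (v≤M (suc s) ≤-refl)))
           (⋆-≤-support (u ∘ suc) v s (u≤1 ∘ suc) (λ i B≤i → u≡0 (suc i) (s≤s B≤i))
                        (λ j j≤s → v≤M j (m≤n⇒m≤1+n j≤s)))

≯0⇒≡0 : ∀ {n} → ¬ 0 < n → n ≡ 0
≯0⇒≡0 ¬0<n = n≤0⇒n≡0 (≮⇒≥ ¬0<n)

⋆-≤1 : ∀ u v t → (∀ i → u i ≤ 1) → (∀ j → v j ≤ 1) →
       (∀ {i j i′ j′} → i + j ≡ t → i′ + j′ ≡ t → 0 < u i → 0 < v j → 0 < u i′ → 0 < v j′ → i ≡ i′) →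
       (u ⋆ v) t ≤ 1
⋆-≤1 u v zero    u≤1 v≤1 _      = *-mono-≤ (u≤1 0) (v≤1 0)
⋆-≤1 u v (suc t) u≤1 v≤1 unique = by (0 <? u 0) (0 <? v (suc t))
  where
  rest = ((u ∘ suc) ⋆ v) t
  rest≤1 : rest ≤ 1
  rest≤1 = ⋆-≤1 (u ∘ suc) v t (u≤1 ∘ suc) v≤1
             (λ e e′ p q p′ q′ → suc-injective (unique (cong suc e) (cong suc e′) p q p′ q′))
  by : Dec (0 < u 0) → Dec (0 < v (suc t)) → u 0 * v (suc t) + rest ≤ 1
  by (no u₀≯0) _ = subst (λ z → z * v (suc t) + rest ≤ 1) (sym (≯0⇒≡0 u₀≯0)) rest≤1
  by (yes _) (no v≯0) = subst (λ z → u 0 * z + rest ≤ 1) (sym (≯0⇒≡0 v≯0))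
                          (subst (λ z → z + rest ≤ 1) (sym (*-zeroʳ (u 0))) rest≤1)
  by (yes u₀>0) (yes v>0) = subst (λ z → u 0 * v (suc t) + z ≤ 1) (sym rest≡0)
                              (≤-trans (≤-reflexive (+-identityʳ _)) (*-mono-≤ (u≤1 0) (v≤1 (suc t))))
    where
    vanish : ∀ i j → i + j ≡ t → u (suc i) ≡ 0 ⊎ v j ≡ 0
    vanish i j i+j≡t with 0 <? u (suc i) | 0 <? v j
    ... | no ¬p | _     = inj₁ (≯0⇒≡0 ¬p)
    ... | yes _ | no ¬q = inj₂ (≯0⇒≡0 ¬q)
    ... | yes p | yes q = ⊥-elim (0≢1+n (unique refl (cong suc i+j≡t) u₀>0 v>0 p q))
    rest≡0 : rest ≡ 0
    rest≡0 = ⋆-vanish (u ∘ suc) v t vanish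

data Generated (e : List ℕ) : ℕ → Set where
  none : Generated e 0
  add  : ∀ {x v} → x ∈ e → Generated e v → Generated e (x + v)

Generated-+ : ∀ {e u v} → Generated e u → Generated e v → Generated e (u + v)
Generated-+         none                 gv = gv
Generated-+ {e} {v = v} (add {x} {w} x∈e gu) gv = subst (Generated e) (sym (+-assoc x w v)) (add x∈e (Generated-+ gu gv))

Generated-* : ∀ {e v} k → Generated e v → Generated e (k * v)
Generated-* zero    _  = none
Generated-* (suc k) gv = Generated-+ gv (Generated-* k gv)

Generated-∈ : ∀ {e x} → x ∈ e → Generated e x
Generated-∈ {e} {x} x∈e = subst (Generated e) (+-identityʳ x) (add x∈e none)

Generated-∷ : ∀ {e y v} → Generated e v → Generated (y ∷ e) v
Generated-∷ none         = none
Generated-∷ (add x∈e gv) = add (there x∈e) (Generated-∷ gv)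

gcdL∣Generated : ∀ {e v} → Generated e v → gcdL e ∣ v
gcdL∣Generated         none         = _ ∣0
gcdL∣Generated {e} (add x∈e gv) = ∣m∣n⇒∣m+n (gcdL-∣ e x∈e) (gcdL∣Generated gv)

Generated-pair : ∀ {x y t} → Generated (x ∷ y ∷ []) t → ∃₂ λ i j → t ≡ x * i + y * j
Generated-pair {x} {y} none = 0 , 0 , sym (cong₂ _+_ (*-zeroʳ x) (*-zeroʳ y))
Generated-pair {x} {y} (add (here refl) gt) with Generated-pair gt
... | i , j , refl = suc i , j , rearrange x i y j
  where
  rearrange : ∀ x i y j → x + (x * i + y * j) ≡ x * suc i + y * j
  rearrange = solve-∀
Generated-pair {x} {y} (add (there (here refl)) gt) with Generated-pair gt
... | i , j , refl = i , suc j , rearrange x i y j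
  where
  rearrange : ∀ x i y j → y + (x * i + y * j) ≡ x * i + y * suc j
  rearrange = solve-∀

-- Bézout's identity for a list, with both coefficients moved to the left.
Generated-gcd-gap : ∀ e → ∃ λ N → Generated e N × Generated e (N + gcdL e)
Generated-gcd-gap [] = 0 , none , none
Generated-gcd-gap (x ∷ e) with Generated-gcd-gap e | Bézout.identity (gcd-GCD x (gcdL e))
... | N , gN , gN+g′ | Bézout.+- X Y eq =
  Y * (N + g′) , Generated-∷ (Generated-* Y gN+g′) ,
  subst (Generated (x ∷ e)) rearranged (Generated-+ (Generated-* X (Generated-∈ (here refl))) (Generated-∷ (Generated-* Y gN)))
  where
  g′ = gcdL e
  rearranged : X * x + Y * N ≡ Y * (N + g′) + gcd x g′
  rearranged = begin
    X * x + Y * N               ≡⟨ cong (_+ Y * N) eq ⟨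
    gcd x g′ + Y * g′ + Y * N   ≡⟨ collect (gcd x g′) Y g′ N ⟩
    Y * (N + g′) + gcd x g′     ∎
    where
    open ≡-Reasoning
    collect : ∀ g Y g′ N → g + Y * g′ + Y * N ≡ Y * (N + g′) + g
    collect = solve-∀
... | N , gN , gN+g′ | Bézout.-+ X Y eq =
  X * x + Y * N , Generated-+ (Generated-* X (Generated-∈ (here refl))) (Generated-∷ (Generated-* Y gN)) ,
  subst (Generated (x ∷ e)) rearranged (Generated-∷ (Generated-* Y gN+g′))
  where
  g′ = gcdL e
  rearranged : Y * (N + g′) ≡ X * x + Y * N + gcd x g′
  rearranged = begin
    Y * (N + g′)                ≡⟨ *-distribˡ-+ Y N g′ ⟩
    Y * N + Y * g′              ≡⟨ +-comm (Y * N) (Y * g′) ⟩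
    Y * g′ + Y * N              ≡⟨ cong (_+ Y * N) eq ⟨
    gcd x g′ + X * x + Y * N    ≡⟨ rotate (gcd x g′) (X * x) (Y * N) ⟩
    X * x + Y * N + gcd x g′    ∎
    where
    open ≡-Reasoning
    rotate : ∀ a b c → a + b + c ≡ b + c + a
    rotate = solve-∀

-- With n₀ = N / G and w ≥ n₀², write w = q n₀ + r with r < n₀ ≤ q; then w G = (q − r) N + r (N + G).
Generated-multiples : ∀ {e G N} → 0 < G → G ∣ N → Generated e N → Generated e (N + G) →
                      ∃ λ B → ∀ t → B ≤ t → G ∣ t → Generated e t
Generated-multiples {e} {G} {N} G>0 (divides n₀ N≡n₀G) gN gN+G = G * (n₀ * n₀) , large
  where
  large : ∀ t → G * (n₀ * n₀) ≤ t → G ∣ t → Generated e t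
  large t B≤t (divides w t≡wG) rewrite t≡wG = by-quotient n₀ refl
    where
    n₀²≤w : n₀ * n₀ ≤ w
    n₀²≤w = *-cancelˡ-≤ G {{>-nonZero G>0}} (subst (G * (n₀ * n₀) ≤_) (*-comm w G) B≤t)
    by-quotient : ∀ m → m ≡ n₀ → Generated e (w * G)
    by-quotient zero m≡n₀ =
      Generated-* w (subst (Generated e) (cong (_+ G) (trans N≡n₀G (cong (_* G) (sym m≡n₀)))) gN+G)
    by-quotient (suc m) m≡n₀ = subst (Generated e) combination (Generated-+ (Generated-* (q ∸ r) gN) (Generated-* r gN+G))
      where
      instance _ = >-nonZero {suc m} (s≤s z≤n)
      q = w / suc m
      r = w % suc m
      1+m≤q : suc m ≤ q
      1+m≤q = subst (_≤ q) (m*n/n≡m (suc m) (suc m)) (/-monoˡ-≤ (suc m) (subst (λ z → z * z ≤ w) (sym m≡n₀) n₀²≤w))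
      q≡r+[q∸r] : q ≡ r + (q ∸ r)
      q≡r+[q∸r] = sym (m+[n∸m]≡n (≤-trans (<⇒≤ (m%n<n w (suc m))) 1+m≤q))
      combination : (q ∸ r) * N + r * (N + G) ≡ w * G
      combination = begin
        (q ∸ r) * N + r * (N + G)
          ≡⟨ cong (λ z → (q ∸ r) * z + r * (z + G)) (trans N≡n₀G (cong (_* G) (sym m≡n₀))) ⟩
        (q ∸ r) * (suc m * G) + r * (suc m * G + G)
          ≡⟨ collect (q ∸ r) (suc m) G r ⟩
        (r + (r + (q ∸ r)) * suc m) * G
          ≡⟨ cong (λ z → (r + z * suc m) * G) q≡r+[q∸r] ⟨
        (r + q * suc m) * G
          ≡⟨ cong (_* G) (m≡m%n+[m/n]*n w (suc m)) ⟨
        w * G ∎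
        where
        open ≡-Reasoning
        collect : ∀ δ m G r → δ * (m * G) + r * (m * G + G) ≡ (r + (r + δ) * m) * G
        collect = solve-∀

Generated-cofinite : ∀ e → 0 < gcdL e → ∃ λ B → ∀ t → B ≤ t → gcdL e ∣ t → Generated e t
Generated-cofinite e g>0 with Generated-gcd-gap e
... | N , gN , gN+g = Generated-multiples g>0 (gcdL∣Generated gN) gN gN+g

∈⇒↭∷ : ∀ {x : ℕ} {e} → x ∈ e → ∃ λ e′ → (e ↭ x ∷ e′) × (suc (length e′) ≡ length e)
∈⇒↭∷ {x} x∈e with ∈-∃++ x∈e
... | ys , zs , refl = ys ++ zs , ↭-shift x ys zs ,
  sym (trans (length-++ ys) (trans (+-suc (length ys) (length zs)) (cong suc (sym (length-++ ys)))))

partitions-+∈ : ∀ {x e} → x ∈ e → Positive e →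
  ∃ λ e′ → (suc (length e′) ≡ length e) × Positive e′ ×
           (∀ u → partitions e (x + u) ≡ partitions e′ (x + u) + partitions e u)
partitions-+∈ {x} {e} x∈e e>0 with ∈⇒↭∷ x∈e
... | e′ , e↭x∷e′ , len = e′ , len , All.tail (All-resp-↭ e↭x∷e′ e>0) , λ u → begin
  partitions e (x + u)                              ≡⟨ partitions-↭ e↭x∷e′ (x + u) ⟩
  partitions (x ∷ e′) (x + u)                       ≡⟨ partitions-+ (All.lookup e>0 x∈e) e′ u ⟩
  partitions e′ (x + u) + partitions (x ∷ e′) u     ≡⟨ cong (partitions e′ (x + u) +_) (partitions-↭ e↭x∷e′ u) ⟨
  partitions e′ (x + u) + partitions e u            ∎
  where open ≡-Reasoning

partitions-mono-Generated : ∀ {e v} → Generated e v → Positive e → ∀ u → partitions e u ≤ partitions e (v + u)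
partitions-mono-Generated none _ u = ≤-refl
partitions-mono-Generated {e} (add {x} {w} x∈e gw) e>0 u with partitions-+∈ x∈e e>0
... | e′ , _ , _ , split = begin
  partitions e u                               ≤⟨ partitions-mono-Generated gw e>0 u ⟩
  partitions e (w + u)                         ≤⟨ m≤n+m _ _ ⟩
  partitions e′ (x + (w + u)) + partitions e (w + u) ≡⟨ split (w + u) ⟨
  partitions e (x + (w + u))                   ≡⟨ cong (partitions e) (+-assoc x w u) ⟨
  partitions e (x + w + u)                     ∎
  where open ≤-Reasoning

partitions-≤-poly : ∀ e → ∀ t → partitions e t ≤ suc t ^ (length e ∸ 1)
partitions-≤-poly []           t = one≤1 t
partitions-≤-poly (c ∷ [])     t =
  subst (_≤ 1) (sym (trans (⋆-comm (multiples c) one t) (⋆-identityˡ (multiples c) t))) (multiples-≤1 c t)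
partitions-≤-poly (c ∷ c′ ∷ e) t = ⋆-≤ (multiples c) (partitions (c′ ∷ e)) t (multiples-≤1 c)
  (λ j j≤t → ≤-trans (partitions-≤-poly (c′ ∷ e) j) (^-monoˡ-≤ (length e) (s≤s j≤t)))

-- Adding a generator x to the argument costs partitions e′ (x + u), where e′ is e without x;
-- by partitions-≤-poly this is O(u^(length e − 2)).
partitions-+-Generated : ∀ {e v} → Generated e v → Positive e →
  ∃ λ C → ∀ u → partitions e (v + u) ≤ partitions e u + C * suc (v + u) ^ (length e ∸ 2)
partitions-+-Generated none _ = 0 , λ u → m≤m+n _ _
partitions-+-Generated {e} (add {x} {w} x∈e gw) e>0 with partitions-+-Generated gw e>0 | partitions-+∈ x∈e e>0
... | C , bound | e′ , len , e′>0 , split = suc C , λ u → begin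
  partitions e (x + w + u)                              ≡⟨ cong (partitions e) (+-assoc x w u) ⟩
  partitions e (x + (w + u))                            ≡⟨ split (w + u) ⟩
  partitions e′ (x + (w + u)) + partitions e (w + u)    ≤⟨ +-mono-≤ (partitions-≤-poly e′ (x + (w + u))) (bound u) ⟩
  suc (x + (w + u)) ^ (length e′ ∸ 1) + (partitions e u + C * suc (w + u) ^ k)
    ≤⟨ +-mono-≤ (≤-reflexive (cong (suc (x + (w + u)) ^_) (cong (_∸ 2) len)))
                (+-monoʳ-≤ (partitions e u) (*-monoʳ-≤ C (^-monoˡ-≤ k (s≤s (m≤n+m (w + u) x))))) ⟩
  suc (x + (w + u)) ^ k + (partitions e u + C * suc (x + (w + u)) ^ k)
    ≡⟨ collect (suc (x + (w + u)) ^ k) (partitions e u) C ⟩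
  partitions e u + suc C * suc (x + (w + u)) ^ k         ≡⟨ cong (λ z → partitions e u + suc C * suc z ^ k) (+-assoc x w u) ⟨
  partitions e u + suc C * suc (x + w + u) ^ k           ∎
  where
  open ≤-Reasoning
  k = length e ∸ 2
  collect : ∀ a b C → a + (b + C * a) ≡ b + suc C * a
  collect = solve-∀

-- With N and N + 1 generated: partitions e (1 + t) ≤ partitions e (N + 1 + t) ≤ partitions e t + O(t^(length e − 2)).
partitions-slowly-varying : ∀ e → Positive e → gcdL e ≡ 1 →
  ∃ λ K → ∀ t → partitions e (suc t) ≤ partitions e t + K * (t + K) ^ (length e ∸ 2)
partitions-slowly-varying e e>0 gcd≡1 with Generated-gcd-gap e
... | N , gN , gN+g with partitions-+-Generated (subst (Generated e) (cong (N +_) gcd≡1) gN+g) e>0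
... | C , bound = C + (N + 2) , λ t → begin
  partitions e (suc t)               ≤⟨ partitions-mono-Generated gN e>0 (suc t) ⟩
  partitions e (N + suc t)           ≡⟨ cong (partitions e) (+-assoc N 1 t) ⟨
  partitions e (N + 1 + t)           ≤⟨ bound t ⟩
  partitions e t + C * suc (N + 1 + t) ^ k
    ≤⟨ +-monoʳ-≤ (partitions e t) (*-mono-≤ (m≤m+n C (N + 2))
         (^-monoˡ-≤ k (≤-trans (≤-reflexive (rearrange N t)) (+-monoʳ-≤ t (m≤n+m (N + 2) C))))) ⟩
  partitions e t + (C + (N + 2)) * (t + (C + (N + 2))) ^ k ∎
  where
  open ≤-Reasoning
  k = length e ∸ 2
  rearrange : ∀ N t → suc (N + 1 + t) ≡ t + (N + 2)
  rearrange = solve-∀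

-- Replacing two generators by their gcd and lcm

-- In series in z, J = (1 − z^L)/(1 − z^x) and A = J/(1 − z^y) counts the representations t = x i + y j
-- with x i < L. Such a representation is unique when g ∣ t and exists for large such t, so
-- Gap = 1/(1 − z^g) − A ≤ 1 has finite support, and 1/((1 − z^g)(1 − z^L)) = 1/((1 − z^x)(1 − z^y)) + Gap/(1 − z^L).
module GcdLcm {x y : ℕ} (x>0 : 0 < x) (y>0 : 0 < y) where

  g L : ℕ
  g = gcd x y
  L = lcm x y

  x∣L : x ∣ L
  x∣L = m∣lcm[m,n] x y

  y∣L : y ∣ L
  y∣L = n∣lcm[m,n] x y

  L>0 : 0 < L
  L>0 with L in L≡
  ... | suc _ = s≤s z≤n
  ... | zero  = ⊥-elim (<⇒≢ (*-mono-≤ x>0 y>0) (sym (trans (sym (gcd*lcm x y)) (trans (cong (g *_) L≡) (*-zeroʳ g)))))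

  g>0 : 0 < g
  g>0 with g in g≡
  ... | suc _ = s≤s z≤n
  ... | zero  = ⊥-elim (<⇒≢ x>0 (sym (0∣⇒≡0 (subst (_∣ x) g≡ (gcd[m,n]∣m x y)))))

  J : Seq
  J t with t <? L
  ... | yes _ = multiples x t
  ... | no _  = 0

  J-< : ∀ {t} → t < L → J t ≡ multiples x t
  J-< {t} t<L with t <? L
  ... | yes _   = refl
  ... | no t≮L = ⊥-elim (t≮L t<L)

  J-≥ : ∀ {t} → ¬ t < L → J t ≡ 0
  J-≥ {t} t≮L with t <? L
  ... | yes t<L = ⊥-elim (t≮L t<L)
  ... | no _    = refl

  J≤multiples : ∀ t → J t ≤ multiples x t
  J≤multiples t with t <? L
  ... | yes _ = ≤-refl
  ... | no _  = z≤n

  J≤1 : ∀ t → J t ≤ 1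
  J≤1 t = ≤-trans (J≤multiples t) (multiples-≤1 x t)

  J-pos : ∀ {t} → 0 < J t → t < L × x ∣ t
  J-pos {t} J>0 with t <? L
  ... | yes t<L = t<L , multiples-pos⇒∣ J>0
  ... | no _    = ⊥-elim (<⇒≱ J>0 z≤n)

  multiples-x-rec : multiples x ≗ J ⊕ shift L (multiples x)
  multiples-x-rec t with <-or-+ L t
  ... | inj₁ t<L = sym (trans (cong₂ _+_ (J-< t<L) (shift-< L _ t<L)) (+-identityʳ _))
  ... | inj₂ (k , t≡L+k) rewrite t≡L+k =
    sym (trans (cong₂ _+_ (J-≥ (λ L+k<L → <⇒≱ L+k<L (m≤m+n L k))) (shift-+ L _ k)) (sym (multiples-+ L k x∣L)))

  A U : Seq
  A = J ⋆ multiples y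
  U = multiples x ⋆ multiples y

  U-rec : U ≗ A ⊕ shift L U
  U-rec = ≗-trans (⋆-cong multiples-x-rec (λ _ → refl))
            (≗-trans (⋆-distribʳ-⊕ (multiples y) J (shift L (multiples x)))
                     (⊕-cong (λ _ → refl) (⋆-shiftˡ L (multiples x) (multiples y))))

  -- Two representations i + j = i′ + j′ with x ∣ i, i′ < L and y ∣ j, j′ differ by a common multiple of x and y.
  A≤multiples-g : ∀ t → A t ≤ multiples g t
  A≤multiples-g t with g ∣? t
  ... | no g∤t = ≤-reflexive (⋆-vanish J (multiples y) t vanish)
    where
    vanish : ∀ i j → i + j ≡ t → J i ≡ 0 ⊎ multiples y j ≡ 0
    vanish i j i+j≡t = by (x ∣? i) (y ∣? j)
      where
      by : Dec (x ∣ i) → Dec (y ∣ j) → J i ≡ 0 ⊎ multiples y j ≡ 0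
      by (no x∤i)  _         = inj₁ (n≤0⇒n≡0 (subst (J i ≤_) (multiples-∤ x∤i) (J≤multiples i)))
      by (yes _)   (no y∤j)  = inj₂ (multiples-∤ y∤j)
      by (yes x∣i) (yes y∣j) =
        ⊥-elim (g∤t (subst (g ∣_) i+j≡t
                 (∣m∣n⇒∣m+n (∣-trans (gcd[m,n]∣m x y) x∣i) (∣-trans (gcd[m,n]∣n x y) y∣j))))
  ... | yes _ = ⋆-≤1 J (multiples y) t J≤1 (multiples-≤1 y) unique
    where
    unique≤ : ∀ {i j i′ j′} → i ≤ i′ → i + j ≡ t → i′ + j′ ≡ t →
              x ∣ i → y ∣ j → i′ < L → x ∣ i′ → y ∣ j′ → i ≡ i′
    unique≤ {i} {j} {i′} {j′} i≤i′ e e′ x∣i y∣j i′<L x∣i′ y∣j′ with i′ ∸ i | m+[n∸m]≡n i≤i′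
    ... | zero  | i+0≡i′   = trans (sym (+-identityʳ i)) i+0≡i′
    ... | suc δ | i+δ≡i′ =
      ⊥-elim (<⇒≱ i′<L (≤-trans (∣⇒≤ L∣δ) (subst (suc δ ≤_) i+δ≡i′ (m≤n+m (suc δ) i))))
      where
      j≡δ+j′ : j ≡ suc δ + j′
      j≡δ+j′ = +-cancelˡ-≡ i _ _ (trans e (trans (sym e′) (trans (cong (_+ j′) (sym i+δ≡i′)) (+-assoc i (suc δ) j′))))
      L∣δ : L ∣ suc δ
      L∣δ = lcm-least (∣m+n∣m⇒∣n (subst (x ∣_) (sym i+δ≡i′) x∣i′) x∣i)
                      (∣m+n∣n⇒∣m (subst (y ∣_) j≡δ+j′ y∣j) y∣j′)
    unique : ∀ {i j i′ j′} → i + j ≡ t → i′ + j′ ≡ t →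
             0 < J i → 0 < multiples y j → 0 < J i′ → 0 < multiples y j′ → i ≡ i′
    unique {i} {j} {i′} {j′} e e′ Ji>0 yj>0 Ji′>0 yj′>0 with ≤-total i i′
    ... | inj₁ i≤i′ = unique≤ i≤i′ e e′ (proj₂ (J-pos Ji>0)) (multiples-pos⇒∣ yj>0)
                                (proj₁ (J-pos Ji′>0)) (proj₂ (J-pos Ji′>0)) (multiples-pos⇒∣ yj′>0)
    ... | inj₂ i′≤i = sym (unique≤ i′≤i e′ e (proj₂ (J-pos Ji′>0)) (multiples-pos⇒∣ yj′>0)
                                     (proj₁ (J-pos Ji>0)) (proj₂ (J-pos Ji>0)) (multiples-pos⇒∣ yj>0))

  Gap : Seq
  Gap t = multiples g t ∸ A t

  Gap≤1 : ∀ t → Gap t ≤ 1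
  Gap≤1 t = ≤-trans (m∸n≤m (multiples g t) (A t)) (multiples-≤1 g t)

  W : Seq
  W = multiples L ⋆ Gap

  U⊕W≗ : U ⊕ W ≗ multiples L ⋆ multiples g
  U⊕W≗ t = recurrence-unique L>0 {λ _ → ⊤} (λ _ _ → tt) U⊕W-rec (λ s _ → ⋆-multiples-rec L>0 (multiples g) s) t tt
    where
    U⊕W-rec : ∀ s → ⊤ → (U ⊕ W) s ≡ multiples g s + shift L (U ⊕ W) s
    U⊕W-rec s _ = begin
      U s + W s                                      ≡⟨ cong₂ _+_ (U-rec s) (⋆-multiples-rec L>0 Gap s) ⟩
      (A s + shift L U s) + (Gap s + shift L W s)    ≡⟨ interchange (A s) _ (Gap s) _ ⟩
      (A s + Gap s) + (shift L U s + shift L W s)    ≡⟨ cong₂ _+_ (m+[n∸m]≡n (A≤multiples-g s)) (sym (shift-⊕ L U W s)) ⟩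
      multiples g s + shift L (U ⊕ W) s              ∎
      where
      open ≡-Reasoning
      interchange : ∀ a b c d → (a + b) + (c + d) ≡ (a + c) + (b + d)
      interchange = solve-∀

  partitions-gcd-lcm : ∀ rest → partitions (g ∷ L ∷ rest) ≗ partitions (x ∷ y ∷ rest) ⊕ Gap ⋆ partitions (L ∷ rest)
  partitions-gcd-lcm rest =
    ≗-trans (≗-sym (⋆-assoc (multiples g) (multiples L) R))
    (≗-trans (⋆-cong (≗-trans (⋆-comm (multiples g) (multiples L)) (≗-sym U⊕W≗)) (λ _ → refl))
    (≗-trans (⋆-distribʳ-⊕ R U W)
    (⊕-cong (⋆-assoc (multiples x) (multiples y) R)
            (≗-trans (⋆-cong (⋆-comm (multiples L) Gap) (λ _ → refl)) (⋆-assoc Gap (multiples L) R)))))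
    where
    R = partitions rest

  gcdL≡g : gcdL (x ∷ y ∷ []) ≡ g
  gcdL≡g = cong (gcd x) (gcd-identityʳ y)

  -- Every large multiple t of g is x i + y j, and reducing x i modulo L gives a representation counted by A.
  Gap-finite : ∃ λ B → ∀ t → B ≤ t → Gap t ≡ 0
  Gap-finite with Generated-cofinite (x ∷ y ∷ []) (subst (0 <_) (sym gcdL≡g) g>0)
  ... | B , generated = B , vanish
    where
    vanish : ∀ t → B ≤ t → Gap t ≡ 0
    vanish t B≤t = by (g ∣? t)
      where
      1≤A : (∃₂ λ i j → t ≡ x * i + y * j) → 1 ≤ A t
      by : Dec (g ∣ t) → Gap t ≡ 0
      by (no g∤t)  = trans (cong (_∸ A t) (multiples-∤ g∤t)) (0∸n≡0 (A t))
      by (yes g∣t) = trans (cong (_∸ A t) (multiples-∣ g∣t))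
        (m≤n⇒m∸n≡0 (1≤A (Generated-pair (generated t B≤t (subst (_∣ t) (sym gcdL≡g) g∣t)))))
      1≤A (i , j , t≡xi+yj) =
        ≤-trans (≤-reflexive (sym (cong₂ _*_ Jk≡1 (multiples-∣ y∣t∸k)))) (⋆-≥-term J (multiples y) k≤t)
        where
        instance _ = >-nonZero L>0
        k = (x * i) % L
        q = (x * i) / L
        xi≡k+qL : x * i ≡ k + q * L
        xi≡k+qL = m≡m%n+[m/n]*n (x * i) L
        k≤t : k ≤ t
        k≤t = ≤-trans (m%n≤m (x * i) L) (subst (x * i ≤_) (sym t≡xi+yj) (m≤m+n _ _))
        Jk≡1 : J k ≡ 1
        Jk≡1 = trans (J-< (m%n<n (x * i) L))
                     (multiples-∣ (∣m+n∣n⇒∣m (subst (x ∣_) xi≡k+qL (∣m⇒∣m*n i ∣-refl)) (∣n⇒∣m*n q x∣L)))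
        t∸k≡ : t ∸ k ≡ q * L + y * j
        t∸k≡ = trans (cong (_∸ k) (trans t≡xi+yj (trans (cong (_+ y * j) xi≡k+qL) (+-assoc k (q * L) (y * j)))))
                     (m+n∸m≡n k _)
        y∣t∸k : y ∣ t ∸ k
        y∣t∸k = subst (y ∣_) (sym t∸k≡) (∣m∣n⇒∣m+n (∣n⇒∣m*n q y∣L) (∣m⇒∣m*n j ∣-refl))

-- c ≳[ k ] c′: the increments of partitions c′ exceed those of partitions c by O(s^k) at most.
record _≳[_]_ (c : List ℕ) (k : ℕ) (c′ : List ℕ) : Set where
  constructor ≳-with
  field
    K     : ℕ
    bound : ∀ s → partitions c′ (suc s) + partitions c s ≤ partitions c (suc s) + partitions c′ s + K * (s + K) ^ k

≳-↭ : ∀ {c c′} k → c ↭ c′ → c ≳[ k ] c′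
≳-↭ k c↭c′ = ≳-with 0 λ s →
  ≤-reflexive (trans (cong₂ _+_ (sym (partitions-↭ c↭c′ (suc s))) (partitions-↭ c↭c′ s)) (sym (+-identityʳ _)))

≳-trans : ∀ {c c′ c″} k → c ≳[ k ] c′ → c′ ≳[ k ] c″ → c ≳[ k ] c″
≳-trans {c} {c′} {c″} k (≳-with K₁ h₁) (≳-with K₂ h₂) = ≳-with (K₁ + K₂) λ s →
  add-increments (partitions c″ (suc s)) (partitions c s) (partitions c (suc s)) (partitions c″ s)
                 (partitions c′ (suc s)) (partitions c′ s) (h₁ s) (h₂ s)
    (≤-trans (+-mono-≤ (*-monoʳ-≤ K₁ (^-monoˡ-≤ k (+-monoʳ-≤ s (m≤m+n K₁ K₂))))
                       (*-monoʳ-≤ K₂ (^-monoˡ-≤ k (+-monoʳ-≤ s (m≤n+m K₂ K₁)))))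
             (≤-reflexive (sym (*-distribʳ-+ ((s + (K₁ + K₂)) ^ k) K₁ K₂))))
  where
  add-increments : ∀ f″ f f₁ f″₀ f′₁ f′₀ {e₁ e₂ e} →
                   f′₁ + f ≤ f₁ + f′₀ + e₁ → f″ + f′₀ ≤ f′₁ + f″₀ + e₂ → e₁ + e₂ ≤ e → f″ + f ≤ f₁ + f″₀ + e
  add-increments f″ f f₁ f″₀ f′₁ f′₀ {e₁} {e₂} {e} h₁ h₂ e₁+e₂≤e =
    +-cancelʳ-≤ (f′₁ + f′₀) _ _ (begin
    f″ + f + (f′₁ + f′₀)              ≡⟨ regroup₁ f″ f f′₁ f′₀ ⟩
    (f″ + f′₀) + (f′₁ + f)            ≤⟨ +-mono-≤ h₂ h₁ ⟩
    (f′₁ + f″₀ + e₂) + (f₁ + f′₀ + e₁) ≡⟨ regroup₂ f′₁ f″₀ e₂ f₁ f′₀ e₁ ⟩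
    f₁ + f″₀ + (e₁ + e₂) + (f′₁ + f′₀) ≤⟨ +-monoˡ-≤ (f′₁ + f′₀) (+-monoʳ-≤ (f₁ + f″₀) e₁+e₂≤e) ⟩
    f₁ + f″₀ + e + (f′₁ + f′₀)        ∎)
    where
    open ≤-Reasoning
    regroup₁ : ∀ a b c d → a + b + (c + d) ≡ (a + d) + (c + b)
    regroup₁ = solve-∀
    regroup₂ : ∀ a b c d e f → (a + b + c) + (d + e + f) ≡ d + b + (f + c) + (a + e)
    regroup₂ = solve-∀

-- By partitions-gcd-lcm the two sides differ by Gap ⋆ partitions (L ∷ rest), whose increments
-- are bounded because Gap ≤ 1 has finite support and partitions (L ∷ rest) varies slowly.
gcd-lcm-≳ : ∀ {x y} (x>0 : 0 < x) (y>0 : 0 < y) rest → let open GcdLcm x>0 y>0 in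
            Positive (L ∷ rest) → gcdL (L ∷ rest) ≡ 1 → (x ∷ y ∷ rest) ≳[ length rest ∸ 1 ] (g ∷ L ∷ rest)
gcd-lcm-≳ {x} {y} x>0 y>0 rest L∷rest>0 gcd≡1
  with partitions-slowly-varying (GcdLcm.L x>0 y>0 ∷ rest) L∷rest>0 gcd≡1 | GcdLcm.Gap-finite x>0 y>0
... | K , slowly | B , Gap≡0 = ≳-with K′ increment
  where
  open GcdLcm x>0 y>0
  k = length rest ∸ 1
  e = L ∷ rest
  c = x ∷ y ∷ rest
  c⁺ = g ∷ L ∷ rest
  Z = Gap ⋆ partitions e
  E : Seq
  E s = K * (s + K) ^ k
  K′ = suc (B * K + K)

  Z-step : ∀ s → Z (suc s) ≤ Z s + (B * E s + 1)
  Z-step s = begin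
    Z (suc s)                                             ≡⟨ ⋆-last Gap (partitions e) s ⟩
    (Gap ⋆ (partitions e ∘ suc)) s + Gap (suc s) * partitions e 0
      ≤⟨ +-mono-≤ (⋆-monoʳ-≤ Gap s (λ j _ → slowly j))
                  (≤-trans (≤-reflexive (trans (cong (Gap (suc s) *_) (partitions-zero e)) (*-identityʳ _))) (Gap≤1 (suc s))) ⟩
    (Gap ⋆ (partitions e ⊕ E)) s + 1                     ≡⟨ cong (_+ 1) (⋆-distribˡ-⊕ Gap (partitions e) E s) ⟩
    Z s + (Gap ⋆ E) s + 1
      ≤⟨ +-monoˡ-≤ 1 (+-monoʳ-≤ (Z s) (⋆-≤-support Gap E s Gap≤1 Gap≡0 (λ j j≤s → *-monoʳ-≤ K (^-monoˡ-≤ k (+-monoˡ-≤ K j≤s))))) ⟩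
    Z s + B * E s + 1                                     ≡⟨ +-assoc (Z s) _ 1 ⟩
    Z s + (B * E s + 1)                                   ∎
    where open ≤-Reasoning

  error-bound : ∀ s → B * E s + 1 ≤ K′ * (s + K′) ^ k
  error-bound s = begin
    B * (K * (s + K) ^ k) + 1  ≤⟨ +-mono-≤ (*-monoʳ-≤ B (*-monoʳ-≤ K (^-monoˡ-≤ k (+-monoʳ-≤ s (m≤n+m K (suc (B * K))))))) 1≤X ⟩
    B * (K * X) + X            ≡⟨ collect B K X ⟩
    suc (B * K) * X            ≤⟨ *-monoˡ-≤ X (s≤s (m≤m+n (B * K) K)) ⟩
    K′ * X                     ∎
    where
    open ≤-Reasoning
    X = (s + K′) ^ k
    1≤X : 1 ≤ X
    1≤X = m^n>0 (s + K′) {{>-nonZero (≤-trans (s≤s z≤n) (m≤n+m K′ s))}} k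
    collect : ∀ B K X → B * (K * X) + X ≡ suc (B * K) * X
    collect = solve-∀

  increment : ∀ s → partitions c⁺ (suc s) + partitions c s ≤ partitions c (suc s) + partitions c⁺ s + K′ * (s + K′) ^ k
  increment s = begin
    partitions c⁺ (suc s) + partitions c s
      ≡⟨ cong (_+ partitions c s) (partitions-gcd-lcm rest (suc s)) ⟩
    partitions c (suc s) + Z (suc s) + partitions c s
      ≤⟨ +-monoˡ-≤ (partitions c s) (+-monoʳ-≤ (partitions c (suc s)) (≤-trans (Z-step s) (+-monoʳ-≤ (Z s) (error-bound s)))) ⟩
    partitions c (suc s) + (Z s + K′ * (s + K′) ^ k) + partitions c s
      ≡⟨ regroup (partitions c (suc s)) (Z s) (K′ * (s + K′) ^ k) (partitions c s) ⟩
    partitions c (suc s) + (partitions c s + Z s) + K′ * (s + K′) ^ k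
      ≡⟨ cong (λ z → partitions c (suc s) + z + K′ * (s + K′) ^ k) (partitions-gcd-lcm rest s) ⟨
    partitions c (suc s) + partitions c⁺ s + K′ * (s + K′) ^ k ∎
    where
    open ≤-Reasoning
    regroup : ∀ a b c d → a + (b + c) + d ≡ a + (d + b) + c
    regroup = solve-∀

-- Reduction to the generators 1, 1

nonMultiples : ℕ → List ℕ → ℕ
nonMultiples k = ∑ (indicator (λ a → ¬? (k ∣? a)))

nonMultiples-∣ : ∀ {k a} l → k ∣ a → nonMultiples k (a ∷ l) ≡ nonMultiples k l
nonMultiples-∣ {k} l k∣a = cong (_+ nonMultiples k l) (indicator-no (λ a → ¬? (k ∣? a)) (λ k∤a → k∤a k∣a))

nonMultiples-∤ : ∀ {k a} l → ¬ k ∣ a → nonMultiples k (a ∷ l) ≡ suc (nonMultiples k l)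
nonMultiples-∤ {k} l k∤a = cong (_+ nonMultiples k l) (indicator-yes (λ a → ¬? (k ∣? a)) k∤a)

nonMultiples-∷-≤ : ∀ k a l → nonMultiples k (a ∷ l) ≤ suc (nonMultiples k l)
nonMultiples-∷-≤ k a l = +-monoˡ-≤ (nonMultiples k l) (indicator-≤1 (λ a → ¬? (k ∣? a)) a)

nonMultiples-∷-≥ : ∀ k a l → nonMultiples k l ≤ nonMultiples k (a ∷ l)
nonMultiples-∷-≥ k a l = m≤n+m (nonMultiples k l) _

nonMultiples-All : ∀ {k l} → All (k ∣_) l → nonMultiples k l ≡ 0
nonMultiples-All []            = refl
nonMultiples-All {l = a ∷ l} (k∣a ∷ k∣l) = trans (nonMultiples-∣ l k∣a) (nonMultiples-All k∣l)

nonMultiples≡0 : ∀ {k} l → nonMultiples k l ≡ 0 → All (k ∣_) l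
nonMultiples≡0     []      _  = []
nonMultiples≡0 {k} (a ∷ l) ≡0 = by (k ∣? a)
  where
  by : Dec (k ∣ a) → All (k ∣_) (a ∷ l)
  by (yes k∣a) = k∣a ∷ nonMultiples≡0 l (trans (sym (nonMultiples-∣ l k∣a)) ≡0)
  by (no k∤a)  = ⊥-elim (0≢1+n (trans (sym ≡0) (nonMultiples-∤ l k∤a)))

gcdL∣All : ∀ l → All (gcdL l ∣_) l
gcdL∣All l = All.tabulate (gcdL-∣ l)

AllButOneCoprime : List ℕ → Set
AllButOneCoprime l = ∀ k → nonMultiples k l ≤ 1 → k ≡ 1

AllButOneCoprime-↭ : ∀ {l l′} → l ↭ l′ → AllButOneCoprime l → AllButOneCoprime l′
AllButOneCoprime-↭ l↭l′ coprime k ≤1 = coprime k (subst (_≤ 1) (sym (∑-↭ _ l↭l′)) ≤1)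

AllButOneCoprime⇒gcdL≡1 : ∀ l → AllButOneCoprime l → gcdL l ≡ 1
AllButOneCoprime⇒gcdL≡1 l coprime = coprime (gcdL l) (≤-reflexive-0 (nonMultiples-All (gcdL∣All l)))
  where
  ≤-reflexive-0 : ∀ {n} → n ≡ 0 → n ≤ 1
  ≤-reflexive-0 refl = z≤n

AllButOneCoprime⇒gcdL-tail≡1 : ∀ a l → AllButOneCoprime (a ∷ l) → gcdL l ≡ 1
AllButOneCoprime⇒gcdL-tail≡1 a l coprime =
  coprime (gcdL l) (≤-trans (nonMultiples-∷-≤ (gcdL l) a l) (s≤s (≤-reflexive (nonMultiples-All (gcdL∣All l)))))

-- A divisor of lcm x y and of rest that is coprime to both x and y (by the hypothesis applied
-- to gcd k x and gcd k y) divides x * y, hence y, hence is 1.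
AllButOneCoprime-gcd-lcm : ∀ x y rest → AllButOneCoprime (x ∷ y ∷ rest) → AllButOneCoprime (gcd x y ∷ lcm x y ∷ rest)
AllButOneCoprime-gcd-lcm x y rest coprime k ≤1 = by (k ∣? gcd x y)
  where
  by : Dec (k ∣ gcd x y) → k ≡ 1
  by (yes k∣g) = coprime k (≤-trans (≤-reflexive same)
                   (≤-trans (nonMultiples-∷-≥ k (lcm x y) rest) (subst (_≤ 1) (nonMultiples-∣ (lcm x y ∷ rest) k∣g) ≤1)))
    where
    same : nonMultiples k (x ∷ y ∷ rest) ≡ nonMultiples k rest
    same = trans (nonMultiples-∣ (y ∷ rest) (∣-trans k∣g (gcd[m,n]∣m x y)))
                 (nonMultiples-∣ rest (∣-trans k∣g (gcd[m,n]∣n x y)))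
  by (no k∤g) = k⊥y (∣-refl , k∣y)
    where
    k∣L∷rest : All (k ∣_) (lcm x y ∷ rest)
    k∣L∷rest = nonMultiples≡0 (lcm x y ∷ rest)
                 (n≤0⇒n≡0 (≤-pred (subst (_≤ 1) (nonMultiples-∤ (lcm x y ∷ rest) k∤g) ≤1)))
    k∣rest : All (k ∣_) rest
    k∣rest = All.tail k∣L∷rest
    gcd-k∣rest : ∀ z → All (gcd k z ∣_) rest
    gcd-k∣rest z = All.map (∣-trans (gcd[m,n]∣m k z)) k∣rest
    k⊥x : Coprime k x
    k⊥x = gcd≡1⇒coprime (coprime (gcd k x)
      (≤-trans (≤-reflexive (nonMultiples-∣ (y ∷ rest) (gcd[m,n]∣n k x)))
      (≤-trans (nonMultiples-∷-≤ (gcd k x) y rest) (s≤s (≤-reflexive (nonMultiples-All (gcd-k∣rest x)))))))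
    k⊥y : Coprime k y
    k⊥y = gcd≡1⇒coprime (coprime (gcd k y)
      (≤-trans (nonMultiples-∷-≤ (gcd k y) x (y ∷ rest))
      (s≤s (≤-reflexive (trans (nonMultiples-∣ rest (gcd[m,n]∣n k y)) (nonMultiples-All (gcd-k∣rest y)))))))
    k∣y : k ∣ y
    k∣y = coprime-divisor k⊥x (∣-trans (All.head k∣L∷rest) (lcm-least {x} {y} (m∣m*n y) (n∣m*n x)))

record Replacement (k : ℕ) (c R : List ℕ) : Set where
  constructor replacement
  field
    positive  : Positive R
    coprime   : AllButOneCoprime R
    dominated : c ≳[ k ] R

Replacement-trans : ∀ {k c c′ c″} → Replacement k c c′ → Replacement k c′ c″ → Replacement k c c″
Replacement-trans {k} (replacement _ _ c≳c′) (replacement c″>0 coprime c′≳c″) =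
  replacement c″>0 coprime (≳-trans k c≳c′ c′≳c″)

Replacement-↭ : ∀ {k c c′ c″} → Replacement k c c′ → c′ ↭ c″ → Replacement k c c″
Replacement-↭ {k} (replacement c′>0 coprime c≳c′) c′↭c″ =
  replacement (All-resp-↭ c′↭c″ c′>0) (AllButOneCoprime-↭ c′↭c″ coprime) (≳-trans k c≳c′ (≳-↭ k c′↭c″))

Replacement-refl : ∀ {k c} → Positive c → AllButOneCoprime c → Replacement k c c
Replacement-refl {k} c>0 coprime = replacement c>0 coprime (≳-↭ k ↭-refl)

↭-Replacement : ∀ {k c c′ R} → c ↭ c′ → Replacement k c′ R → Replacement k c R
↭-Replacement {k} c↭c′ (replacement R>0 coprime c′≳R) = replacement R>0 coprime (≳-trans k (≳-↭ k c↭c′) c′≳R)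

gcd-lcm-step : ∀ x y rest → Positive (x ∷ y ∷ rest) → AllButOneCoprime (x ∷ y ∷ rest) →
               Replacement (length rest ∸ 1) (x ∷ y ∷ rest) (gcd x y ∷ lcm x y ∷ rest)
gcd-lcm-step x y rest (x>0 ∷ y>0 ∷ rest>0) coprime =
  replacement (g>0 ∷ L>0 ∷ rest>0) coprime′
              (gcd-lcm-≳ x>0 y>0 rest (L>0 ∷ rest>0) (AllButOneCoprime⇒gcdL-tail≡1 g (L ∷ rest) coprime′))
  where
  open GcdLcm x>0 y>0
  coprime′ = AllButOneCoprime-gcd-lcm x y rest coprime

↭-park : ∀ (a b : ℕ) us vs → (a ∷ b ∷ us ++ vs) ↭ (a ∷ us ++ b ∷ vs)
↭-park a b us vs = ↭-prep a (↭-sym (↭-shift b us vs))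

-- Successive gcd-lcm steps along x ∷ us collect gcdL (x ∷ us) in front; the lcms are parked behind us.
sweep : ∀ {N} x us vs → length (x ∷ us ++ vs) ≡ N → Positive (x ∷ us ++ vs) → AllButOneCoprime (x ∷ us ++ vs) →
        ∃ λ us′ → length us′ ≡ length us × Replacement (N ∸ 3) (x ∷ us ++ vs) (gcdL (x ∷ us) ∷ us′ ++ vs)
sweep {N} x [] vs _ c>0 coprime =
  [] , refl , subst (λ h → Replacement (N ∸ 3) (x ∷ vs) (h ∷ vs)) (sym (gcd-identityʳ x)) (Replacement-refl c>0 coprime)
sweep x (y ∷ us) vs refl c>0 coprime
  with step ← gcd-lcm-step x y (us ++ vs) c>0 coprime
  with us′ , len′ , swept ← sweep (gcd x y) us (lcm x y ∷ vs) (sym (↭-length (↭-park (gcd x y) (lcm x y) us vs)))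
                                  (All-resp-↭ (↭-park _ _ us vs) (Replacement.positive step))
                                  (AllButOneCoprime-↭ (↭-park _ _ us vs) (Replacement.coprime step))
  = us′ ++ [ lcm x y ] , trans (length-++ us′) (trans (+-comm (length us′) 1) (cong suc len′)) ,
    subst (Replacement _ (x ∷ y ∷ us ++ vs)) reassociate (Replacement-trans (Replacement-↭ step park) swept)
  where
  park = ↭-park (gcd x y) (lcm x y) us vs
  reassociate : gcdL (gcd x y ∷ us) ∷ us′ ++ lcm x y ∷ vs ≡ gcdL (x ∷ y ∷ us) ∷ (us′ ++ [ lcm x y ]) ++ vs
  reassociate = cong₂ _∷_ (gcd-assoc x y (gcdL us)) (sym (++-assoc us′ [ lcm x y ] vs))

sweep-all : ∀ x us → Positive (x ∷ us) → AllButOneCoprime (x ∷ us) →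
            ∃ λ us′ → length us′ ≡ length us × Replacement (length us ∸ 2) (x ∷ us) (1 ∷ us′)
sweep-all x us c>0 coprime =
  result (sweep x us [] (cong (λ l → length (x ∷ l)) us++[]≡us)
                (subst (λ l → Positive (x ∷ l)) (sym us++[]≡us) c>0)
                (subst (λ l → AllButOneCoprime (x ∷ l)) (sym us++[]≡us) coprime))
  where
  us++[]≡us = ++-identityʳ us
  result : (∃ λ us′ → length us′ ≡ length us × Replacement (length us ∸ 2) (x ∷ us ++ []) (gcdL (x ∷ us) ∷ us′ ++ [])) →
           ∃ λ us′ → length us′ ≡ length us × Replacement (length us ∸ 2) (x ∷ us) (1 ∷ us′)
  result (us′ , len , r) = us′ , len ,
    subst₂ (λ l R → Replacement (length us ∸ 2) (x ∷ l) R) us++[]≡us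
           (cong₂ _∷_ (AllButOneCoprime⇒gcdL≡1 (x ∷ us) coprime) (++-identityʳ us′)) r

sweep-behind-1 : ∀ k y us → Positive (1 ∷ y ∷ us) → AllButOneCoprime (1 ∷ y ∷ us) → length (y ∷ us) ≡ suc (suc k) →
                 ∃ λ R → length R ≡ suc k × Replacement k (1 ∷ y ∷ us) (1 ∷ 1 ∷ R)
sweep-behind-1 k y us c>0 coprime len =
  result (sweep y us [ 1 ] (trans (sym (↭-length rotate)) (cong suc len))
                (All-resp-↭ rotate c>0) (AllButOneCoprime-↭ rotate coprime))
  where
  rotate : (1 ∷ y ∷ us) ↭ (y ∷ us ++ [ 1 ])
  rotate = ∷↭∷ʳ 1 (y ∷ us)
  result : (∃ λ us′ → length us′ ≡ length us × Replacement k (y ∷ us ++ [ 1 ]) (gcdL (y ∷ us) ∷ us′ ++ [ 1 ])) →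
           ∃ λ R → length R ≡ suc k × Replacement k (1 ∷ y ∷ us) (1 ∷ 1 ∷ R)
  result (us′ , len′ , r) = us′ , trans len′ (suc-injective len) ,
    ↭-Replacement rotate (Replacement-↭ (subst (λ h → Replacement k (y ∷ us ++ [ 1 ]) (h ∷ us′ ++ [ 1 ]))
                                               (AllButOneCoprime⇒gcdL-tail≡1 1 (y ∷ us) coprime) r)
                                        (↭-prep 1 (↭-sym (∷↭∷ʳ 1 us′))))

reduce-to-ones : ∀ x y z rest → Positive (x ∷ y ∷ z ∷ rest) → AllButOneCoprime (x ∷ y ∷ z ∷ rest) →
                 ∃ λ R → length R ≡ suc (length rest) × Replacement (length rest) (x ∷ y ∷ z ∷ rest) (1 ∷ 1 ∷ R)
reduce-to-ones x y z rest c>0 coprime = continue (sweep-all x (y ∷ z ∷ rest) c>0 coprime)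
  where
  continue : (∃ λ us′ → length us′ ≡ suc (suc (length rest)) × Replacement (length rest) (x ∷ y ∷ z ∷ rest) (1 ∷ us′)) →
             ∃ λ R → length R ≡ suc (length rest) × Replacement (length rest) (x ∷ y ∷ z ∷ rest) (1 ∷ 1 ∷ R)
  continue (y′ ∷ us , len , r) =
    let R , lenR , r′ = sweep-behind-1 (length rest) y′ us (Replacement.positive r) (Replacement.coprime r) len
    in R , lenR , Replacement-trans r r′

EventuallyIncreasing : (ℕ → ℕ) → Set
EventuallyIncreasing u = ∃ λ N → ∀ s → N ≤ s → u s < u (suc s)

partitions-[1] : ∀ t → partitions (1 ∷ []) t ≡ 1
partitions-[1] t = trans (⋆-comm (multiples 1) one t) (trans (⋆-identityˡ (multiples 1) t) (multiples-∣ (1∣ t)))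

partitions-1∷-mono : ∀ R {a b} → a ≤ b → partitions (1 ∷ R) a ≤ partitions (1 ∷ R) b
partitions-1∷-mono R {a} {b} a≤b with b ∸ a | m+[n∸m]≡n a≤b
... | δ | refl = go δ
  where
  go : ∀ δ → partitions (1 ∷ R) a ≤ partitions (1 ∷ R) (a + δ)
  go zero    = ≤-reflexive (cong (partitions (1 ∷ R)) (sym (+-identityʳ a)))
  go (suc δ) = ≤-trans (go δ) (subst (partitions (1 ∷ R) (a + δ) ≤_) (cong (partitions (1 ∷ R)) (sym (+-suc a δ)))
                                      (≤-trans (m≤n+m _ _) (≤-reflexive (sym (partitions-+ (s≤s z≤n) R (a + δ))))))

-- As G = partitions (1 ∷ R) is monotone, the terms for 0, r, …, r q of (multiples r ⋆ G) (r q + y) dominate G y.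
⋆-multiples-≥ : ∀ {r} → 0 < r → ∀ R q y →
                suc q * partitions (1 ∷ R) y ≤ (multiples r ⋆ partitions (1 ∷ R)) (r * q + y)
⋆-multiples-≥ {r} r>0 R zero y =
  subst (λ z → partitions (1 ∷ R) y + 0 ≤ (multiples r ⋆ partitions (1 ∷ R)) z) (sym (cong (_+ y) (*-zeroʳ r)))
    (subst (partitions (1 ∷ R) y + 0 ≤_) (sym (⋆-multiples-rec r>0 _ y)) (+-monoʳ-≤ _ z≤n))
⋆-multiples-≥ {r} r>0 R (suc q) y = begin
  partitions (1 ∷ R) y + suc q * partitions (1 ∷ R) y
    ≤⟨ +-mono-≤ (partitions-1∷-mono R (≤-trans (m≤n+m y (r * q)) (m≤n+m _ r))) (⋆-multiples-≥ r>0 R q y) ⟩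
  partitions (1 ∷ R) (r + (r * q + y)) + (multiples r ⋆ partitions (1 ∷ R)) (r * q + y)
    ≡⟨ ⋆-multiples-+ r>0 _ (r * q + y) ⟨
  (multiples r ⋆ partitions (1 ∷ R)) (r + (r * q + y))
    ≡⟨ cong (multiples r ⋆ partitions (1 ∷ R)) (trans (cong (_+ y) (*-suc r q)) (+-assoc r (r * q) y)) ⟨
  (multiples r ⋆ partitions (1 ∷ R)) (r * suc q + y) ∎
  where open ≤-Reasoning

partitions-1∷-≥-poly : ∀ R → Positive R → ∀ q → suc q ^ length R ≤ partitions (1 ∷ R) (sum R * q)
partitions-1∷-≥-poly []       _            q = ≤-reflexive (sym (partitions-[1] (0 * q)))
partitions-1∷-≥-poly (r ∷ R) (r>0 ∷ R>0) q = begin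
  suc q * suc q ^ length R                              ≤⟨ *-monoʳ-≤ (suc q) (partitions-1∷-≥-poly R R>0 q) ⟩
  suc q * partitions (1 ∷ R) (sum R * q)                ≤⟨ ⋆-multiples-≥ r>0 R q (sum R * q) ⟩
  (multiples r ⋆ partitions (1 ∷ R)) (r * q + sum R * q) ≡⟨ cong (multiples r ⋆ partitions (1 ∷ R)) (*-distribʳ-+ q r (sum R)) ⟨
  partitions (r ∷ 1 ∷ R) ((r + sum R) * q)              ≡⟨ partitions-swap 1 r R ((r + sum R) * q) ⟨
  partitions (1 ∷ r ∷ R) ((r + sum R) * q)              ∎
  where open ≤-Reasoning

^-distribʳ-* : ∀ a b k → (a * b) ^ k ≡ a ^ k * b ^ k
^-distribʳ-* a b zero    = refl
^-distribʳ-* a b (suc k) = trans (cong (a * b *_) (^-distribʳ-* a b k)) (interchange a b (a ^ k) (b ^ k))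
  where
  interchange : ∀ a b x y → a * b * (x * y) ≡ a * x * (b * y)
  interchange = solve-∀

-- With q = ⌊(s + 1) / M⌋ ≥ K (M + K)^k, both s + K ≤ (M + K)(q + 1) and K (M + K)^k (q + 1)^k < (q + 1)^(k + 1).
polynomial-overtaken : ∀ (G : ℕ → ℕ) {M} K k → 0 < M → (∀ {a b} → a ≤ b → G a ≤ G b) →
                       (∀ q → suc q ^ suc k ≤ G (M * q)) →
                       ∃ λ N → ∀ s → N ≤ s → K * (s + K) ^ k < G (suc s)
polynomial-overtaken G {M} K k M>0 G-mono G-≥ = M * Z , overtaken
  where
  instance _ = >-nonZero M>0
  Z = K * (M + K) ^ k
  overtaken : ∀ s → M * Z ≤ s → K * (s + K) ^ k < G (suc s)
  overtaken s MZ≤s = begin-strict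
    K * (s + K) ^ k                  ≤⟨ *-monoʳ-≤ K (^-monoˡ-≤ k s+K≤) ⟩
    K * ((M + K) * suc q) ^ k        ≡⟨ cong (K *_) (^-distribʳ-* (M + K) (suc q) k) ⟩
    K * ((M + K) ^ k * suc q ^ k)    ≡⟨ *-assoc K _ _ ⟨
    Z * suc q ^ k                    <⟨ *-monoˡ-< (suc q ^ k) {{>-nonZero (m^n>0 (suc q) k)}} (s≤s Z≤q) ⟩
    suc q * suc q ^ k                ≤⟨ G-≥ q ⟩
    G (M * q)                        ≤⟨ G-mono (subst (_≤ suc s) (*-comm q M) (m/n*n≤m (suc s) M)) ⟩
    G (suc s)                        ∎
    where
    open ≤-Reasoning
    q = suc s / M
    Z≤q : Z ≤ q
    Z≤q = subst (_≤ q) (trans (cong (_/ M) (*-comm M Z)) (m*n/n≡m Z M)) (/-monoˡ-≤ M (m≤n⇒m≤1+n MZ≤s))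
    1+s<M*[1+q] : suc s < M * suc q
    1+s<M*[1+q] = begin-strict
      suc s                 ≡⟨ m≡m%n+[m/n]*n (suc s) M ⟩
      suc s % M + q * M     <⟨ +-monoˡ-< (q * M) (m%n<n (suc s) M) ⟩
      M + q * M             ≡⟨ cong (M +_) (*-comm q M) ⟩
      M + M * q             ≡⟨ *-suc M q ⟨
      M * suc q             ∎
    s+K≤ : s + K ≤ (M + K) * suc q
    s+K≤ = ≤-trans (+-mono-≤ (≤-trans (n≤1+n s) (<⇒≤ 1+s<M*[1+q])) (m≤m*n K (suc q)))
                   (≤-reflexive (sym (*-distribʳ-+ (suc q) M K)))

-- The increments of partitions (1 ∷ 1 ∷ R) are the values of partitions (1 ∷ R), which grow like s^(k+1).
≳-ones⇒increasing : ∀ {c k R} → Positive R → length R ≡ suc k → c ≳[ k ] (1 ∷ 1 ∷ R) →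
                    EventuallyIncreasing (partitions c)
≳-ones⇒increasing {c} {k} {r ∷ R} (r>0 ∷ R>0) len (≳-with K dominated)
  with N , overtaken ← polynomial-overtaken (partitions (1 ∷ r ∷ R)) K k (≤-trans r>0 (m≤m+n r (sum R)))
                         (partitions-1∷-mono (r ∷ R))
                         (λ q → subst (λ m → suc q ^ m ≤ partitions (1 ∷ r ∷ R) (sum (r ∷ R) * q)) len
                                      (partitions-1∷-≥-poly (r ∷ R) (r>0 ∷ R>0) q))
  = N , λ s N≤s → +-cancelʳ-< (G (suc s)) (partitions c s) (partitions c (suc s))
                    (≤-<-trans (increment s) (+-monoʳ-< (partitions c (suc s)) (overtaken s N≤s)))
  where
  G = partitions (1 ∷ r ∷ R)
  c* = 1 ∷ 1 ∷ r ∷ R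
  increment : ∀ s → partitions c s + G (suc s) ≤ partitions c (suc s) + K * (s + K) ^ k
  increment s = +-cancelʳ-≤ (partitions c* s) _ _ (begin
    partitions c s + G (suc s) + partitions c* s         ≡⟨ rotate (partitions c s) (G (suc s)) (partitions c* s) ⟩
    (G (suc s) + partitions c* s) + partitions c s       ≡⟨ cong (_+ partitions c s) (partitions-+ (s≤s z≤n) (1 ∷ r ∷ R) s) ⟨
    partitions c* (suc s) + partitions c s               ≤⟨ dominated s ⟩
    partitions c (suc s) + partitions c* s + K * (s + K) ^ k ≡⟨ swap (partitions c (suc s)) (partitions c* s) _ ⟩
    partitions c (suc s) + K * (s + K) ^ k + partitions c* s ∎)
    where
    open ≤-Reasoning
    rotate : ∀ a b c → a + b + c ≡ (b + c) + a
    rotate = solve-∀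
    swap : ∀ a b c → a + b + c ≡ a + c + b
    swap = solve-∀

-- With two generators, AllButOneCoprime forces both to be 1, and partitions (1 ∷ 1 ∷ []) s = s + 1.
eventually-increasing : ∀ c → Positive c → AllButOneCoprime c → 2 ≤ length c → EventuallyIncreasing (partitions c)
eventually-increasing (x ∷ [])  _ _ (s≤s ())
eventually-increasing (x ∷ y ∷ []) _ coprime _ =
  0 , λ s _ → subst (λ c → partitions c s < partitions c (suc s)) (sym x∷y≡1∷1) (increasing s)
  where
  x≡1 : x ≡ 1
  x≡1 = coprime x (≤-trans (≤-reflexive (nonMultiples-∣ (y ∷ []) (∣-refl {x}))) (nonMultiples-∷-≤ x y []))
  y≡1 : y ≡ 1
  y≡1 = coprime y (≤-trans (nonMultiples-∷-≤ y x (y ∷ [])) (s≤s (≤-reflexive (nonMultiples-∣ [] (∣-refl {y})))))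
  x∷y≡1∷1 : x ∷ y ∷ [] ≡ 1 ∷ 1 ∷ []
  x∷y≡1∷1 = cong₂ (λ a b → a ∷ b ∷ []) x≡1 y≡1
  increasing : ∀ s → partitions (1 ∷ 1 ∷ []) s < partitions (1 ∷ 1 ∷ []) (suc s)
  increasing s = subst (partitions (1 ∷ 1 ∷ []) s <_) (sym (partitions-+ (s≤s z≤n) (1 ∷ []) s))
                   (subst (λ z → partitions (1 ∷ 1 ∷ []) s < z + partitions (1 ∷ 1 ∷ []) s)
                          (sym (partitions-[1] (suc s))) (n<1+n _))
eventually-increasing (x ∷ y ∷ z ∷ rest) c>0 coprime _ =
  let R , len , r = reduce-to-ones x y z rest c>0 coprime
  in ≳-ones⇒increasing (All.tail (All.tail (Replacement.positive r))) len (Replacement.dominated r)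

all-but-one-∣ : ∀ {n} (g : Fin n → ℕ) k → 0 < n → nonMultiples k (tabulate g) ≤ 1 →
                ∃ λ i → ∀ j → j ≢ i → k ∣ g j
all-but-one-∣ {suc n} g k _ = go n g
  where
  go : ∀ n (g : Fin (suc n) → ℕ) → nonMultiples k (tabulate g) ≤ 1 → ∃ λ i → ∀ j → j ≢ i → k ∣ g j
  go zero    g ≤1 = zero , λ where
    zero 0≢0 → ⊥-elim (0≢0 refl)
  go (suc n) g ≤1 = by (k ∣? g zero)
    where
    by : Dec (k ∣ g zero) → ∃ λ i → ∀ j → j ≢ i → k ∣ g j
    by (no k∤g₀) = zero , λ where
      zero    0≢0 → ⊥-elim (0≢0 refl)
      (suc j) _   → tabulate⁻ {f = g ∘ suc} (nonMultiples≡0 (tabulate (g ∘ suc))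
                                 (n≤0⇒n≡0 (≤-pred (subst (_≤ 1) (nonMultiples-∤ (tabulate (g ∘ suc)) k∤g₀) ≤1)))) j
    by (yes k∣g₀) =
      let i , k∣g = go n (g ∘ suc) (subst (_≤ 1) (nonMultiples-∣ (tabulate (g ∘ suc)) k∣g₀) ≤1)
      in suc i , λ where
        zero    _      → k∣g₀
        (suc j) j≢1+i → k∣g j (j≢1+i ∘ cong suc)

m*n∣m⇒n≡1 : ∀ {m n} → 0 < m → m * n ∣ m → n ≡ 1
m*n∣m⇒n≡1 {m} {n} m>0 mn∣m =
  *-cancelˡ-≡ n 1 m {{>-nonZero m>0}} (trans (∣-antisym mn∣m (m∣m*n n)) (sym (*-identityʳ m)))

module Setting {n : ℕ} (a : Fin n → ℕ) (a>0 : ∀ i → 0 < a i) (gcd≡1 : gcdV a ≡ 1) (2≤n : 2 ≤ n) where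

  d : Fin n → ℕ
  d = dᵢ a

  p : ℕ
  p = pOf a

  ∈-others : ∀ {i j} → j ≢ i → j ∈ others i
  ∈-others {i} {j} j≢i = ∈-filter⁺ (≢? i) {xs = allFin n} (∈-allFin j) j≢i

  ∈-others⁻ : ∀ {i j} → j ∈ others i → j ≢ i
  ∈-others⁻ {i} j∈ = proj₂ (∈-filter⁻ (≢? i) {xs = allFin n} j∈)

  d∣a : ∀ {i j} → j ≢ i → d i ∣ a j
  d∣a {i} j≢i = gcdL-∣ (map a (others i)) (∈-map⁺ a (∈-others j≢i))

  ∣d : ∀ {k} i → (∀ j → j ≢ i → k ∣ a j) → k ∣ d i
  ∣d {k} i k∣a = ∣gcdL (map a (others i)) k∣
    where
    k∣ : ∀ {x} → x ∈ map a (others i) → k ∣ x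
    k∣ x∈ with ∈-map⁻ a x∈
    ... | j , j∈ , refl = k∣a j (∈-others⁻ j∈)

  ∣all⇒≡1 : ∀ {k} → (∀ j → k ∣ a j) → k ≡ 1
  ∣all⇒≡1 {k} k∣a = ∣1⇒≡1 (subst (k ∣_) gcd≡1 (∣gcdL (map a (allFin n)) k∣))
    where
    k∣ : ∀ {x} → x ∈ map a (allFin n) → k ∣ x
    k∣ x∈ with ∈-map⁻ a x∈
    ... | j , _ , refl = k∣a j

  d⊥a : ∀ i → Coprime (d i) (a i)
  d⊥a i (k∣d , k∣a) = ∣all⇒≡1 k∣
    where
    k∣ : ∀ j → _ ∣ a j
    k∣ j with j Fin.≟ i
    ... | yes refl = k∣a
    ... | no j≢i   = ∣-trans k∣d (d∣a j≢i)

  d⊥d : ∀ {i j} → i ≢ j → Coprime (d i) (d j)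
  d⊥d {i} {j} i≢j (k∣dᵢ , k∣dⱼ) = ∣all⇒≡1 k∣
    where
    k∣ : ∀ l → _ ∣ a l
    k∣ l with l Fin.≟ i
    ... | yes refl = ∣-trans k∣dⱼ (d∣a i≢j)
    ... | no l≢i   = ∣-trans k∣dᵢ (d∣a l≢i)

  another : ∀ i → ∃ λ j → j ≢ i
  another = go 2≤n
    where
    go : ∀ {m} → 2 ≤ m → (i : Fin m) → ∃ λ j → j ≢ i
    go (s≤s (s≤s _)) zero    = suc zero , λ ()
    go (s≤s (s≤s _)) (suc i) = zero , λ ()

  d>0 : ∀ i → 0 < d i
  d>0 i with d i in dᵢ≡ | another i
  ... | suc _ | _       = s≤s z≤n
  ... | zero  | j , j≢i = ⊥-elim (<⇒≢ (a>0 j) (sym (0∣⇒≡0 (subst (_∣ a j) dᵢ≡ (d∣a j≢i)))))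

  d₋ : Fin n → ℕ
  d₋ i = product (map d (others i))

  p≡d*d₋ : ∀ i → p ≡ d i * d₋ i
  p≡d*d₋ i = product-split d i (Unique.allFin⁺ n) (∈-allFin i)

  d∣p : ∀ i → d i ∣ p
  d∣p i = divides (d₋ i) (trans (p≡d*d₋ i) (*-comm (d i) (d₋ i)))

  p∣ : ∀ {x} → (∀ i → d i ∣ x) → p ∣ x
  p∣ d∣x = product-∣ d (Unique.allFin⁺ n) d⊥d (λ {j} _ → d∣x j)

  d₋∣a : ∀ i → d₋ i ∣ a i
  d₋∣a i = product-∣ d (Unique.filter⁺ (≢? i) (Unique.allFin⁺ n)) d⊥d
             (λ j∈ → d∣a (λ i≡j → ∈-others⁻ j∈ (sym i≡j)))

  d∣d₋ : ∀ {i j} → i ≢ j → d i ∣ d₋ j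
  d∣d₋ {i} {j} i≢j = divides (product (map d (filter (≢? i) (others j))))
    (trans (product-split d i (Unique.filter⁺ (≢? j) (Unique.allFin⁺ n)) (∈-others i≢j)) (*-comm (d i) _))

  d₋>0 : ∀ i → 0 < d₋ i
  d₋>0 i with d₋ i in d₋≡
  ... | suc _ = s≤s z≤n
  ... | zero  = ⊥-elim (<⇒≢ (a>0 i) (sym (0∣⇒≡0 (subst (_∣ a i) d₋≡ (d₋∣a i)))))

  a≡d₋*a′ : ∀ i → a i ≡ d₋ i * a′ a i
  a≡d₋*a′ i with d₋ i | d₋∣a i | d₋>0 i
  ... | suc _ | d₋∣aᵢ | _ = sym (m*[n/m]≡n d₋∣aᵢ)

  a′>0 : ∀ i → 0 < a′ a i
  a′>0 i with a′ a i in a′≡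
  ... | suc _ = s≤s z≤n
  ... | zero  = ⊥-elim (<⇒≢ (a>0 i) (sym (trans (a≡d₋*a′ i) (trans (cong (d₋ i *_) a′≡) (*-zeroʳ (d₋ i))))))

  a*d≡p*a′ : ∀ i → a i * d i ≡ p * a′ a i
  a*d≡p*a′ i = begin
    a i * d i               ≡⟨ cong (_* d i) (a≡d₋*a′ i) ⟩
    d₋ i * a′ a i * d i     ≡⟨ rotate (d₋ i) (a′ a i) (d i) ⟩
    d i * d₋ i * a′ a i     ≡⟨ cong (_* a′ a i) (p≡d*d₋ i) ⟨
    p * a′ a i              ∎
    where
    open ≡-Reasoning
    rotate : ∀ x y z → x * y * z ≡ z * x * y
    rotate = solve-∀

  p>0 : 0 < p
  p>0 = subst (0 <_) (sym (p≡d*d₋ i)) (*-mono-≤ (d>0 i) (d₋>0 i))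
    where
    i : Fin n
    i = first 2≤n
      where
      first : ∀ {m} → 2 ≤ m → Fin m
      first (s≤s _) = zero

  partitions-shifted : ∀ b → (∀ i → b i < d i) → ∀ s →
    partitions (tabulate a) (s * p + dot a b) ≡ partitions (tabulate (λ i → a i * d i)) (s * p)
  partitions-shifted b b<d s =
    trans (partitions-sieve n a d b a>0 d>0 (λ i j i≢j → d∣a (i≢j ∘ sym)) d⊥a b<d (s * p + dot a b)
             (λ i → ∣⇒+≡mod (dot a b) (∣n⇒∣m*n s (d∣p i))))
          (trans (cong (shift (dot a b) _) (+-comm (s * p) (dot a b))) (shift-+ (dot a b) _ (s * p)))

  partitions-at-multiple : ∀ s → partitions (tabulate a) (s * p) ≡ partitions (tabulate (λ i → a i * d i)) (s * p)
  partitions-at-multiple s = trans (cong (partitions (tabulate a)) (sym s*p+0≡s*p)) (partitions-shifted (λ _ → 0) d>0 s)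
    where
    s*p+0≡s*p : s * p + dot a (λ _ → 0) ≡ s * p
    s*p+0≡s*p = trans (cong (s * p +_) (dot-zeroʳ a)) (+-identityʳ (s * p))

  f-constant-on-shifts : ∀ s b → (∀ i → b i < d i) → f a (s * p + dot a b) ≡ f a (s * p)
  f-constant-on-shifts s b b<d = begin
    f a (s * p + dot a b)                              ≡⟨ f≡partitions a a>0 _ ⟩
    partitions (tabulate a) (s * p + dot a b)          ≡⟨ partitions-shifted b b<d s ⟩
    partitions (tabulate (λ i → a i * d i)) (s * p)    ≡⟨ partitions-at-multiple s ⟨
    partitions (tabulate a) (s * p)                    ≡⟨ f≡partitions a a>0 _ ⟨
    f a (s * p)                                        ∎
    where open ≡-Reasoning

  f-at-multiples-of-p : ∀ s → f a (s * p) ≡ f (a′ a) s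
  f-at-multiples-of-p s = begin
    f a (s * p)                                          ≡⟨ f≡partitions a a>0 _ ⟩
    partitions (tabulate a) (s * p)                      ≡⟨ partitions-at-multiple s ⟩
    partitions (tabulate (λ i → a i * d i)) (s * p)      ≡⟨ cong₂ partitions (tabulate-cong a*d≡p*a′) (*-comm s p) ⟩
    partitions (tabulate (λ i → p * a′ a i)) (p * s)     ≡⟨ cong (λ l → partitions l (p * s)) (map-tabulate (a′ a) (p *_)) ⟨
    partitions (map (p *_) (tabulate (a′ a))) (p * s)    ≡⟨ partitions-scale p>0 (tabulate⁺ a′>0) s ⟩
    partitions (tabulate (a′ a)) s                       ≡⟨ f≡partitions (a′ a) a′>0 s ⟨
    f (a′ a) s                                           ∎
    where open ≡-Reasoning

  -- Chinese remaindering: bᵢ ≡ t·aᵢ⁻¹ (mod dᵢ) makes a · b ≡ t modulo every dᵢ, hence modulo p.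
  large-arguments-are-shifts : ∃[ N ] (∀ t → N ≤ t → ∃[ s ] ∃[ b ] ((∀ i → b i < d i) × t ≡ s * p + dot a b))
  large-arguments-are-shifts = dot a d , representation
    where
    representation : ∀ t → dot a d ≤ t → ∃[ s ] ∃[ b ] ((∀ i → b i < d i) × t ≡ s * p + dot a b)
    representation t a·d≤t = quotient p∣t∸r , b , b<d , t≡
      where
      u : Fin n → ℕ
      u i = proj₁ (inverse-mod (d>0 i) (d⊥a i))
      b : Fin n → ℕ
      b i = _%_ (t * u i) (d i) {{>-nonZero (d>0 i)}}
      b<d : ∀ i → b i < d i
      b<d i = m%n<n (t * u i) (d i) {{>-nonZero (d>0 i)}}
      r = dot a b
      r≡t : ∀ i → r ≡ t [mod d i ]
      r≡t i = ≡mod-trans (dot-≡mod a b i (λ j j≢i → d∣a j≢i))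
                (≡mod-inverse {a = a i} (proj₂ (inverse-mod (d>0 i) (d⊥a i))) (≡mod-% (t * u i) (d i) {{>-nonZero (d>0 i)}}))
      r≤t : r ≤ t
      r≤t = ≤-trans (dot-monoʳ-≤ a (λ i → <⇒≤ (b<d i))) a·d≤t
      p∣t∸r : p ∣ t ∸ r
      p∣t∸r = p∣ (λ i → ≡mod⇒∣∸ r≤t (r≡t i))
      t≡ : t ≡ quotient p∣t∸r * p + r
      t≡ = trans (sym (m∸n+n≡m r≤t)) (cong (_+ r) (m∣n⇒n≡quotient*m p∣t∸r))

  -- If k divides a′ⱼ for all j ≠ i, then dᵢ k divides aⱼ = d₋ⱼ a′ⱼ for all j ≠ i, hence dᵢ k ∣ dᵢ.
  a′-coprime : AllButOneCoprime (tabulate (a′ a))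
  a′-coprime k ≤1 with i , k∣a′ ← all-but-one-∣ (a′ a) k (≤-trans (s≤s z≤n) 2≤n) ≤1 =
    m*n∣m⇒n≡1 (d>0 i) (∣d i (λ j j≢i →
      subst (d i * k ∣_) (sym (a≡d₋*a′ j)) (*-pres-∣ (d∣d₋ (j≢i ∘ sym)) (k∣a′ j j≢i))))

  f-increasing-on-multiples-of-p : ∃[ N ] (∀ s → N ≤ s → f a (s * p) < f a (suc s * p))
  f-increasing-on-multiples-of-p with N , increasing ← eventually-increasing (tabulate (a′ a)) (tabulate⁺ a′>0) a′-coprime
                                (subst (2 ≤_) (sym (length-tabulate (a′ a))) 2≤n)
    = N , λ s N≤s → subst₂ _<_ (sym (trans (f-at-multiples-of-p s) (f≡partitions (a′ a) a′>0 s)))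
                              (sym (trans (f-at-multiples-of-p (suc s)) (f≡partitions (a′ a) a′>0 (suc s)))) (increasing s N≤s)

theorem1p8 : (n : ℕ) → 2 ≤ n → (a : Fin n → ℕ) → (∀ i → 0 < a i) → gcdV a ≡ 1 →
      ((s : ℕ) (b : Fin n → ℕ) → (∀ i → b i < dᵢ a i) →
          f a (s * pOf a + dot a b) ≡ f a (s * pOf a))
    × (∃[ N ] ((t : ℕ) → N ≤ t → ∃[ s ] ∃[ b ]
          ((∀ i → b i < dᵢ a i) × t ≡ s * pOf a + dot a b)))
    × ((s : ℕ) → f a (s * pOf a) ≡ f (a′ a) s)
    × (∃[ N ] ((s : ℕ) → N ≤ s → f a (s * pOf a) < f a (suc s * pOf a)))
theorem1p8 n 2≤n a a>0 gcd≡1 =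
  f-constant-on-shifts , large-arguments-are-shifts , f-at-multiples-of-p , f-increasing-on-multiples-of-p
  where open Setting a a>0 gcd≡1 2≤n
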